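{- Let $(P,\Pi\cup\theta\Pi)$ be a permutation-bipartition pair and fix a linear ordering $b_1\prec b_2\prec\cdots\prec b_n$ of $S$. Let $\mathfrak{F}$ be its region reduction diagram with respect to this ordering. Then the embeddings $Q\in S(\Pi\cup\theta\Pi)$ are in one-to-one correspondence with the directed paths of $\mathfrak{F}$ from the root (level $0$) to level $n$, and under this correspondence the sum of the weights along the path corresponding to $Q$ equals $\|PQ\|$, i.e. twice the number of regions of the embedding $Q$.
   Context: Let $S$ and $S_\theta$ be disjoint finite sets of equal size and $\theta$ a fixed-point-free involution of $S\cup S_\theta$ mapping $S$ onto $S_\theta$. Permutations act on the right: $xP$ is the image of $x$, $x(PQ)=(xP)Q$, and a cycle $(x_1,\ldots,x_m)$ means $x_iP=x_{i+1}$, $x_mP=x_1$. $\|P\|$ is the number of cycles of $P$ (fixed points counted). A permutation-bipartition pair $(P,\Pi\cup\theta\Pi)$ consists of a permutation $P$ of $S\cup S_\theta$ such that whenever $(x_1,x_2,\ldots,x_m)$ is a cycle of $P$, $(\theta x_1,\theta x_m,\ldots,\theta x_2)$ is also a cycle, a partition $\Pi$ of $S$ and $\theta\Pi=\{\theta\Pi_i\}$; $a\equiv b\pmod\Pi$ means same block. An embedding is a permutation $Q$ whose cycles are, for each block $\Pi_i=\{a_1,\ldots,a_m\}$, a cycle $(a_{j_1},\ldots,a_{j_m})$ and the cycle $(\theta a_{j_m},\ldots,\theta a_{j_2},\theta a_{j_1})$ for some ordering $j_1,\ldots,j_m$; $S(\Pi\cup\theta\Pi)$ is the set of embeddings; the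 number of regions of the embedding $Q$ is $\|PQ\|/2$. $P/x$ deletes $x$ from the cycle decomposition; $\Pi-x$ deletes $x$ from its block. Reductions. For $a\neq b$, $a\equiv b\pmod\Pi$: $\Pi_a=\Pi-b$, $\theta\Pi_a=\theta\Pi-\theta b$; $P_a=P(b,a,bP)/b$ if $a\neq bP\neq b$; $P_a=P(b,a)/b$ if $a=bP\neq b$; $P_a=P/b$ if $bP=b$; $P_{a,\theta a}=(\theta a,\theta b,\theta bP_a^{ -1})P_a/\theta b$ if $\theta a\neq\theta bP_a^{ -1}\neq\theta b$; $P_{a,\theta a}=(\theta b,\theta a)P_a/\theta b$ if $\theta a=\theta bP_a^{ -1}\neq\theta b$; $P_{a,\theta a}=P_a/\theta b$ if $\theta bP_a^{ -1}=\theta b$; and $(P,\Pi\cup\theta\Pi)|^{a\rightarrow b}_{\theta a\rightarrow\theta b}=(P_{a,\theta a},\Pi_a\cup\theta\Pi_a)$. For a singleton block $\{b\}$: $P_b=P/b$, $P_{b,\theta b}=P_b/\theta b$, $\Pi_b,\theta\Pi_b$ obtained by removing the blocks $\{b\},\{\theta b\}$, and $(P,\Pi\cup\theta\Pi)|^{b\rightarrow b}_{\theta b\rightarrow\theta b}=(P_{b,\theta b},\Pi_b\cup\theta\Pi_b)$. Region reduction diagram $\mathfrak{F}$: a rooted tree with weighted edges whose level-$0$ vertex is $(P,\Pi\cup\theta\Pi)$. Given a vertex $(P',\Pi'\cup\theta\Pi')$ at level $i<n$: if $\{b_{i+1}\}$ is a block of $\Pi'$, it has exactly one child $(P',\Pi'\cup\theta\Pi')|^{b_{i+1}\rightarrow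 b_{i+1}}_{\theta b_{i+1}\rightarrow\theta b_{i+1}}$, joined by an edge of weight $\delta_{b_{i+1},b_{i+1}P'}+\delta_{\theta b_{i+1},\theta b_{i+1}P'_{b_{i+1}}}$; otherwise it has one child $(P',\Pi'\cup\theta\Pi')|^{a\rightarrow b_{i+1}}_{\theta a\rightarrow\theta b_{i+1}}$ for each $a\neq b_{i+1}$ with $a\equiv b_{i+1}\pmod{\Pi'}$, joined by an edge of weight $\delta_{a,b_{i+1}P'}+\delta_{\theta aP'_a,\theta b_{i+1}}$ ($\delta$ the Kronecker delta). -}

module Defs where

open import Data.Nat using (ℕ; zero; suc; _+_; _*_)
open import Data.Fin using (Fin) renaming (_≟_ to _≟F_)
open import Data.Fin.Permutation using (Permutation′; _⟨$⟩ʳ_)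
open import Data.Sum using (_⊎_; inj₁; inj₂)
open import Data.Sum.Properties using (≡-dec)
open import Data.Bool using (Bool; true; false; if_then_else_; _∧_; _∨_; not; T)
open import Data.List using (List; []; _∷_; _++_; map; upTo; allFin; tabulate)
open import Data.Bool.ListAction using (any)
open import Data.Product using (Σ; ∃; _×_; _,_)
open import Relation.Binary.PropositionalEquality using (_≡_)
open import Relation.Nullary.Decidable using (⌊_⌋)

-- Ground set.  S is represented by Fin n (elements inj₁ k), S_θ by a
-- second copy of Fin n (elements inj₂ k), and θ swaps the two copies.

X : ℕ → Set
X n = Fin n ⊎ Fin n

θ : ∀ {n} → X n → X n
θ (inj₁ k) = inj₂ k
θ (inj₂ k) = inj₁ k

infix 4 _==_
_==_ : ∀ {n} → X n → X n → Bool
x == y = ⌊ ≡-dec _≟F_ _≟F_ x y ⌋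

_==F_ : ∀ {n} → Fin n → Fin n → Bool
a ==F b = ⌊ a ≟F b ⌋

δ : ∀ {n} → X n → X n → ℕ
δ x y = if x == y then 1 else 0

allX : ∀ n → List (X n)
allX n = map inj₁ (allFin n) ++ map inj₂ (allFin n)

-- Permutations, given by their forward map and their inverse map.
-- Permutations act on the right: x (P · Q) = (x P) Q.

record Perm (n : ℕ) : Set where
  constructor perm
  field
    fwd : X n → X n
    bwd : X n → X n
open Perm public

infixl 7 _·_
_·_ : ∀ {n} → Perm n → Perm n → Perm n
P · Q = perm (λ x → fwd Q (fwd P x)) (λ x → bwd P (bwd Q x))

swapF : ∀ {n} → X n → X n → X n → X n
swapF x y z = if z == x then y else (if z == y then x else z)

tr : ∀ {n} → X n → X n → Perm n
tr x y = perm (swapF x y) (swapF x y)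

cyc3F : ∀ {n} → X n → X n → X n → X n → X n
cyc3F x y z w = if w == x then y else (if w == y then z else (if w == z then x else w))

c3 : ∀ {n} → X n → X n → X n → Perm n
c3 x y z = perm (cyc3F x y z) (cyc3F x z y)

-- P / x : delete x from the cycle decomposition of P
del : ∀ {n} → X n → Perm n → Perm n
del x P = perm (λ y → if fwd P y == x then fwd P x else fwd P y)
               (λ y → if bwd P y == x then bwd P x else bwd P y)

iter : ∀ {A : Set} → (A → A) → ℕ → A → A
iter f zero x = x
iter f (suc m) x = f (iter f m x)

-- ‖P‖ : the number of cycles (orbits, fixed points counted) of a
-- permutation of S ∪ S_θ (2n elements): the number of elements that do
-- not lie in the orbit of an element enumerated before them.
sameOrbit : ∀ {n} → (X n → X n) → X n → X n → Bool
sameOrbit {n} f x y = any (λ m → iter f m x == y) (upTo (2 * n))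

cyclesFrom : ∀ {n} → (X n → X n) → List (X n) → List (X n) → ℕ
cyclesFrom f seen [] = 0
cyclesFrom f seen (x ∷ xs) =
  if any (λ s → sameOrbit f s x) seen
  then cyclesFrom f (x ∷ seen) xs
  else suc (cyclesFrom f (x ∷ seen) xs)

‖_‖ : ∀ {n} → Perm n → ℕ
‖_‖ {n} P = cyclesFrom (fwd P) [] (allX n)

-- Permutation-bipartition pairs.  The partition Π of S is given by a
-- block labelling blk : Fin n → Fin n (a ≡ b mod Π iff blk a ≡ blk b);
-- θΠ is determined by Π.

IsPermutation : ∀ {n} → Perm n → Set
IsPermutation {n} P = (∀ (x : X n) → fwd P (bwd P x) ≡ x) × (∀ (x : X n) → bwd P (fwd P x) ≡ x)

-- whenever (x₁,…,x_m) is a cycle of P, (θx₁, θx_m, …, θx₂) is a cycle,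
-- i.e. (θ x) P = θ (x P⁻¹) for all x
ThetaCompatible : ∀ {n} → Perm n → Set
ThetaCompatible {n} P = ∀ (x : X n) → fwd P (θ x) ≡ θ (bwd P x)

IsPBPair : ∀ {n} → Perm n → (Fin n → Fin n) → Set
IsPBPair P blk = IsPermutation P × ThetaCompatible P

-- Embeddings Q ∈ S(Π ∪ θΠ): the cycles of Q are, for each block
-- Π_i = {a₁,…,a_m}, a cycle (a_{j₁},…,a_{j_m}) through exactly that block,
-- together with the cycle (θa_{j_m},…,θa_{j₂},θa_{j₁}).

record IsEmbedding {n} (blk : Fin n → Fin n) (Q : Perm n) : Set where
  field
    isPerm    : IsPermutation Q
    intoBlock : ∀ (k : Fin n) → ∃ λ l → fwd Q (inj₁ k) ≡ inj₁ l × blk l ≡ blk k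
    oneCycle  : ∀ (k l : Fin n) → blk k ≡ blk l → ∃ λ m → iter (fwd Q) m (inj₁ k) ≡ inj₁ l
    -- on S_θ, Q runs through the θ-images of each such cycle in reverse
    thetaRev  : ∀ (k : Fin n) → fwd Q (θ (fwd Q (inj₁ k))) ≡ θ (inj₁ k)

Embedding : ∀ {n} → (Fin n → Fin n) → Set
Embedding {n} blk = Σ (Perm n) (IsEmbedding blk)

_≈E_ : ∀ {n} {blk : Fin n → Fin n} → Embedding blk → Embedding blk → Set
_≈E_ {n} (Q , _) (Q′ , _) = ∀ (x : X n) → fwd Q x ≡ fwd Q′ x

-- Reductions (a, b ∈ S, a ≡ b mod Π).  The partition part Π_a = Π - b
-- is tracked below by the list of still-present elements of S.

redA : ∀ {n} → Perm n → Fin n → Fin n → Perm n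
redA P a b =
  let A = inj₁ a ; B = inj₁ b ; bP = fwd P (inj₁ b) in
  if bP == B then del B P
  else (if A == bP then del B (P · tr B A)
        else del B (P · c3 B A bP))

redAθ : ∀ {n} → Perm n → Fin n → Fin n → Perm n
redAθ P a b =
  let R = redA P a b ; tA = θ (inj₁ a) ; tB = θ (inj₁ b) ; u = bwd R tB in
  if u == tB then del tB R
  else (if tA == u then del tB (tr tB tA · R)
        else del tB (c3 tA tB u · R))

redB : ∀ {n} → Perm n → Fin n → Perm n
redB P b = del (inj₁ b) P

redBθ : ∀ {n} → Perm n → Fin n → Perm n
redBθ P b = del (θ (inj₁ b)) (redB P b)

-- A vertex at level i is (P′, Π′ ∪ θΠ′) where
-- Π′ is Π restricted to the remaining elements b_{i+1}, …, b_n of S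
-- (given by the list `rest = b_{i+1} ∷ …`).  Path P′ rest is the type of
-- directed paths from that vertex down to level n; the root-to-level-n
-- paths of 𝔉 are Path P (b₁ ∷ … ∷ b_n).

_∈ᵇ_ : ∀ {n} → Fin n → List (Fin n) → Bool
a ∈ᵇ xs = any (a ==F_) xs

-- {b} is a block of Π′ (Π′ = Π restricted to the elements of b ∷ bs)
isSingleton : ∀ {n} → (Fin n → Fin n) → Fin n → List (Fin n) → Bool
isSingleton blk b bs = not (any (λ c → not (c ==F b) ∧ (blk c ==F blk b)) (b ∷ bs))

isChild : ∀ {n} → (Fin n → Fin n) → Fin n → Fin n → List (Fin n) → Bool
isChild blk a b bs = not (a ==F b) ∧ (a ∈ᵇ (b ∷ bs)) ∧ (blk a ==F blk b)

data Path {n} (blk : Fin n → Fin n) : Perm n → List (Fin n) → Set where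
  done   : ∀ {P} → Path blk P []
  single : ∀ {P b bs} → T (isSingleton blk b bs) →
           Path blk (redBθ P b) bs → Path blk P (b ∷ bs)
  child  : ∀ {P b bs} (a : Fin n) → T (isChild blk a b bs) →
           Path blk (redAθ P a b) bs → Path blk P (b ∷ bs)

weight : ∀ {n} {blk : Fin n → Fin n} {P : Perm n} {bs : List (Fin n)} →
         Path blk P bs → ℕ
weight done = 0
weight {P = P} (single {b = b} _ p) =
  δ (inj₁ b) (fwd P (inj₁ b)) + δ (θ (inj₁ b)) (fwd (redB P b) (θ (inj₁ b))) + weight p
weight {P = P} (child {b = b} a _ p) =
  δ (inj₁ a) (fwd P (inj₁ b)) + δ (fwd (redA P a b) (θ (inj₁ a))) (θ (inj₁ b)) + weight p

-- the ordering b₁ ≺ … ≺ b_n of S given by a bijection σ (b_{i+1} = σ i)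
ordered : ∀ {n} → Permutation′ n → List (Fin n)
ordered σ = tabulate (σ ⟨$⟩ʳ_)

-- Read backwards, a root-to-leaf path of the region reduction diagram rebuilds an embedding:
-- a child edge labelled a re-inserts b after a (and θb before θa), a singleton edge adds the
-- fixed points b and θb. Conversely the path of an embedding Q is found by deleting b₁, b₂, …
-- from Q in turn, the label at a non-singleton block being the current predecessor of b.
-- For the weight, one reduction step deletes two points from the cycles of P·Q; a deletion
-- loses one cycle exactly when the deleted point is fixed, and these fixedness tests are the
-- Kronecker deltas of the edge. Once everything is deleted only the 2n fixed points remain,
-- so the weights along the path add up to ‖PQ‖.

module Submission where

open import Defs
open import Data.Bool using (Bool; true; false; if_then_else_; _∧_; _∨_; not; T)
open import Data.Bool.ListAction using (any)
open import Data.Bool.Properties using (T-irrelevant; not-injective; ∧-zeroʳ; ∧-identityʳ)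
open import Data.Empty using (⊥-elim)
open import Data.Fin using (Fin; zero; suc; toℕ; join; splitAt) renaming (_≟_ to _≟F_)
open import Data.Fin.Permutation using (Permutation′; _⟨$⟩ʳ_; _⟨$⟩ˡ_; inverseʳ; inverseˡ)
open import Data.Fin.Properties using (pigeonhole; splitAt-join; toℕ<n; suc-injective; 0≢1+n)
open import Data.List using (List; []; _∷_; map; length; tabulate; allFin; upTo)
open import Data.List.Membership.Propositional using (_∈_; _∉_)
open import Data.List.Membership.Propositional.Properties
  using (∈-upTo⁺; ∈-map⁺; ∈-map⁻; ∈-++⁺ˡ; ∈-++⁺ʳ; ∈-allFin; ∈-tabulate⁺; ∈-tabulate⁻)
open import Data.List.Properties using (length-tabulate; length-++; length-map)
open import Data.List.Relation.Unary.All as All using (All; []; _∷_; universal)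
open import Data.List.Relation.Unary.All.Properties using (All¬⇒¬Any)
open import Data.List.Relation.Unary.AllPairs using ([]; _∷_)
open import Data.List.Relation.Unary.Any using (here; there)
open import Data.List.Relation.Unary.Unique.Propositional using (Unique)
open import Data.List.Relation.Unary.Unique.Propositional.Properties using (++⁺; map⁺; allFin⁺)
open import Data.Nat using (ℕ; zero; suc; _+_; _*_; _∸_; _<_; _≤_)
open import Data.Nat.Properties
  using (+-assoc; +-comm; +-identityʳ; +-suc; +-cancelʳ-≡; +-commutativeSemigroup; m+[n∸m]≡n; m∸n+n≡m; m∸n≤m;
         m<n⇒0<n∸m; m≤n⇒m<n∨m≡n; n<1+n; <⇒≤; <⇒≤pred; <-≤-trans; ≤-trans)
open import Algebra.Properties.CommutativeSemigroup +-commutativeSemigroup using (xy∙z≈xz∙y; xy∙z≈x∙zy)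
open import Data.Product using (Σ; _×_; _,_; ∃; proj₁; proj₂)
open import Data.Sum using (_⊎_; inj₁; inj₂)
open import Data.Sum.Properties using (≡-dec)
open import Data.Unit using (⊤; tt)
open import Function using (id)
open import Function.Definitions using (Injective)
open import Relation.Binary.Definitions using (DecidableEquality)
open import Relation.Binary.PropositionalEquality
open import Relation.Nullary using (yes; no; ¬_)
open import Relation.Nullary.Decidable using (⌊_⌋; isYes≗does; dec-true; dec-false)

true⇔true⇒≡ : {a b : Bool} → (a ≡ true → b ≡ true) → (b ≡ true → a ≡ true) → a ≡ b
true⇔true⇒≡ {true} {true} f g = refl
true⇔true⇒≡ {true} {false} f g = sym (f refl)
true⇔true⇒≡ {false} {true} f g = g refl
true⇔true⇒≡ {false} {false} f g = refl

∨-duplicateˡ : ∀ a c → (a ∨ c) ≡ (a ∨ (a ∨ c))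
∨-duplicateˡ true c = refl
∨-duplicateˡ false c = refl

∨-exchangeˡ : ∀ a b c → (a ∨ (b ∨ c)) ≡ (b ∨ (a ∨ c))
∨-exchangeˡ true b c with b
... | true = refl
... | false = refl
∨-exchangeˡ false b c = refl

∨-exchange-assoc : ∀ a c d → ((a ∨ c) ∨ d) ≡ (c ∨ (a ∨ d))
∨-exchange-assoc true c d with c
... | true = refl
... | false = refl
∨-exchange-assoc false c d = refl

indicator : Bool → ℕ
indicator b = if b then 1 else 0

if-true : ∀ {A : Set} {b} {x y : A} → b ≡ true → (if b then x else y) ≡ x
if-true refl = refl

if-false : ∀ {A : Set} {b} {x y : A} → b ≡ false → (if b then x else y) ≡ y
if-false refl = refl

T-not⇒false : ∀ {x} → T (not x) → x ≡ false
T-not⇒false {false} _ = refl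
T-not⇒false {true} ()

∧-true⇒ˡ : ∀ {x y} → (x ∧ y) ≡ true → x ≡ true
∧-true⇒ˡ {true} e = refl

∧-true⇒ʳ : ∀ {x y} → (x ∧ y) ≡ true → y ≡ true
∧-true⇒ʳ {true} e = e

T⇒≡true : ∀ {x} → T x → x ≡ true
T⇒≡true {true} _ = refl

≡true⇒T : ∀ {x} → x ≡ true → T x
≡true⇒T refl = tt

true-or-false : (b : Bool) → (b ≡ true) ⊎ (b ≡ false)
true-or-false true = inj₁ refl
true-or-false false = inj₂ refl

module _ {A : Set} where

  any-true⁺ : (p : A → Bool) {z : A} (L : List A) → z ∈ L → p z ≡ true → any p L ≡ true
  any-true⁺ p (x ∷ L) (here refl) e rewrite e = refl
  any-true⁺ p (x ∷ L) (there m) e rewrite any-true⁺ p L m e with p x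
  ... | true = refl
  ... | false = refl

  any-true⁻ : (p : A → Bool) (L : List A) → any p L ≡ true → ∃ λ z → z ∈ L × p z ≡ true
  any-true⁻ p [] ()
  any-true⁻ p (x ∷ L) e with p x in px
  ... | true = x , here refl , px
  ... | false with any-true⁻ p L e
  ... | z , m , q = z , there m , q

  any-false⁺ : (p : A → Bool) (L : List A) → (∀ z → z ∈ L → p z ≡ false) → any p L ≡ false
  any-false⁺ p [] h = refl
  any-false⁺ p (x ∷ L) h rewrite h x (here refl) = any-false⁺ p L (λ z m → h z (there m))

  any-false⁻ : (p : A → Bool) (L : List A) {z : A} → any p L ≡ false → z ∈ L → p z ≡ false
  any-false⁻ p L {z} e m with p z in pz
  ... | false = refl
  ... | true with trans (sym (any-true⁺ p L m pz)) e
  ... | ()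

  any-resp-sameElements : (p : A → Bool) (L M : List A) → (∀ z → z ∈ L → z ∈ M) → (∀ z → z ∈ M → z ∈ L) →
                          any p L ≡ any p M
  any-resp-sameElements p L M h1 h2 =
    true⇔true⇒≡ (λ e → let (z , m , q) = any-true⁻ p L e in any-true⁺ p M (h1 z m) q)
                (λ e → let (z , m , q) = any-true⁻ p M e in any-true⁺ p L (h2 z m) q)

  any-cong : (p q : A → Bool) (L : List A) → (∀ z → p z ≡ q z) → any p L ≡ any q L
  any-cong p q [] h = refl
  any-cong p q (x ∷ L) h rewrite h x | any-cong p q L h = refl

  iter-+ : (f : A → A) (a b : ℕ) (x : A) → iter f (a + b) x ≡ iter f a (iter f b x)
  iter-+ f zero b x = refl
  iter-+ f (suc a) b x = cong f (iter-+ f a b x)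

  iter-injective : (f : A → A) → Injective _≡_ _≡_ f → ∀ m {x y} → iter f m x ≡ iter f m y → x ≡ y
  iter-injective f inj zero e = e
  iter-injective f inj (suc m) e = iter-injective f inj m (inj e)

  iter-cong : (f g : A → A) → (∀ x → f x ≡ g x) → ∀ m x → iter f m x ≡ iter g m x
  iter-cong f g h zero x = refl
  iter-cong f g h (suc m) x rewrite iter-cong f g h m x = h _

  iter-fixed : ∀ (x : A) (g : A → A) → g x ≡ x → ∀ m → iter g m x ≡ x
  iter-fixed x g e zero = refl
  iter-fixed x g e (suc m) rewrite iter-fixed x g e m = e

module BooleanEquality {A : Set} (_≟_ : DecidableEquality A) where

  ≟-refl : (x : A) → ⌊ x ≟ x ⌋ ≡ true
  ≟-refl x = trans (isYes≗does (x ≟ x)) (dec-true (x ≟ x) refl)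

  ≟-≢ : {x y : A} → x ≢ y → ⌊ x ≟ y ⌋ ≡ false
  ≟-≢ {x} {y} x≢y = trans (isYes≗does (x ≟ y)) (dec-false (x ≟ y) x≢y)

  ≟-≡ : {x y : A} → ⌊ x ≟ y ⌋ ≡ true → x ≡ y
  ≟-≡ {x} {y} e with x ≟ y
  ... | yes p = p

  ≟-false⇒≢ : {x y : A} → ⌊ x ≟ y ⌋ ≡ false → x ≢ y
  ≟-false⇒≢ {x} {y} e p with x ≟ y
  ... | no ¬p = ¬p p

-- Orbits and cycle counts
module _ {n : ℕ} where

  ==F-refl : (x : Fin n) → (x ==F x) ≡ true
  ==F-refl = BooleanEquality.≟-refl _≟F_

  ==F-≢ : {x y : Fin n} → x ≢ y → (x ==F y) ≡ false
  ==F-≢ = BooleanEquality.≟-≢ _≟F_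

  ==F-≡ : {x y : Fin n} → (x ==F y) ≡ true → x ≡ y
  ==F-≡ = BooleanEquality.≟-≡ _≟F_

  ==-refl : (x : X n) → (x == x) ≡ true
  ==-refl = BooleanEquality.≟-refl (≡-dec _≟F_ _≟F_)

  ==-≢ : {x y : X n} → x ≢ y → (x == y) ≡ false
  ==-≢ = BooleanEquality.≟-≢ (≡-dec _≟F_ _≟F_)

  ==-≡ : {x y : X n} → (x == y) ≡ true → x ≡ y
  ==-≡ = BooleanEquality.≟-≡ (≡-dec _≟F_ _≟F_)

  ==-false⇒≢ : {x y : X n} → (x == y) ≡ false → x ≢ y
  ==-false⇒≢ = BooleanEquality.≟-false⇒≢ (≡-dec _≟F_ _≟F_)

  ≡⇒== : {x y : X n} → x ≡ y → (x == y) ≡ true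
  ≡⇒== {x} refl = ==-refl x

  data ==-View (x y : X n) : Bool → Set where
    isEq : x ≡ y → ==-View x y true
    isNeq : x ≢ y → ==-View x y false

  ==-view : ∀ (x y : X n) → ==-View x y (x == y)
  ==-view x y with x == y in e
  ... | true = isEq (==-≡ e)
  ... | false = isNeq (==-false⇒≢ e)

  ==-sym : (x y : X n) → (x == y) ≡ (y == x)
  ==-sym x y with x == y | ==-view x y | y == x | ==-view y x
  ... | true | isEq _ | true | _ = refl
  ... | true | isEq p | false | isNeq q = ⊥-elim (q (sym p))
  ... | false | isNeq p | true | isEq q = ⊥-elim (p (sym q))
  ... | false | _ | false | _ = refl

  toFin : X n → Fin (n + n)
  toFin = join n n

  toFin-injective : ∀ {x y} → toFin x ≡ toFin y → x ≡ y
  toFin-injective {x} {y} e = trans (sym (splitAt-join n n x)) (trans (cong (splitAt n) e) (splitAt-join n n y))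

  orbit-period : (f : X n → X n) → Injective _≡_ _≡_ f → (x : X n) → ∃ λ p → 0 < p × p ≤ n + n × iter f p x ≡ x
  orbit-period f inj x with pigeonhole (n<1+n (n + n)) (λ i → toFin (iter f (toℕ i) x))
  ... | i , j , i<j , e = p , 0<p , p≤ , x≡ where
    ti = toℕ i
    tj = toℕ j
    p = tj ∸ ti
    0<p : 0 < p
    0<p = m<n⇒0<n∸m i<j
    p≤ : p ≤ n + n
    p≤ = ≤-trans (m∸n≤m tj ti) (<⇒≤pred (toℕ<n j))
    x≡ : iter f p x ≡ x
    x≡ = iter-injective f inj ti (begin
      iter f ti (iter f p x) ≡⟨ iter-+ f ti p x ⟨
      iter f (ti + p) x      ≡⟨ cong (λ k → iter f k x) (m+[n∸m]≡n (<⇒≤ i<j)) ⟩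
      iter f tj x            ≡⟨ toFin-injective e ⟨
      iter f ti x            ∎)
      where open ≡-Reasoning

  iter-below-period : (f : X n → X n) (x : X n) (p : ℕ) → 0 < p → iter f p x ≡ x → ∀ m → ∃ λ m' → m' < p × iter f m' x ≡ iter f m x
  iter-below-period f x p 0<p e zero = 0 , 0<p , refl
  iter-below-period f x p 0<p e (suc m) with iter-below-period f x p 0<p e m
  ... | m' , m'<p , e' with m≤n⇒m<n∨m≡n m'<p
  ... | inj₁ sm'<p = suc m' , sm'<p , cong f e'
  ... | inj₂ sm'≡p = 0 , 0<p , trans (sym e) (trans (cong (λ k → iter f k x) (sym sm'≡p)) (cong f e'))

  sameOrbit-sound : (f : X n → X n) (x y : X n) → sameOrbit f x y ≡ true → ∃ λ m → iter f m x ≡ y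
  sameOrbit-sound f x y e with any-true⁻ (λ m → iter f m x == y) (upTo (2 * n)) e
  ... | m , _ , q = m , ==-≡ q

  sameOrbit-complete : (f : X n → X n) → Injective _≡_ _≡_ f → (x y : X n) (m : ℕ) → iter f m x ≡ y → sameOrbit f x y ≡ true
  sameOrbit-complete f inj x y m e with orbit-period f inj x
  ... | p , 0<p , p≤ , px with iter-below-period f x p 0<p px m
  ... | m' , m'<p , e' = any-true⁺ (λ k → iter f k x == y) (upTo (2 * n)) (∈-upTo⁺ lt) (trans (cong (_== y) e') (trans (cong (_== y) e) (==-refl y)))
    where
    lt : m' < 2 * n
    lt = subst (m' <_) (cong (n +_) (sym (+-identityʳ n))) (<-≤-trans m'<p p≤)

  orbit-sym : (f : X n → X n) → Injective _≡_ _≡_ f → (x y : X n) (m : ℕ) → iter f m x ≡ y → ∃ λ k → iter f k y ≡ x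
  orbit-sym f inj x y m e with orbit-period f inj x
  ... | p , 0<p , _ , px with iter-below-period f x p 0<p px m
  ... | m' , m'<p , e' = p ∸ m' , (begin
        iter f (p ∸ m') y ≡⟨ cong (iter f (p ∸ m')) (sym (trans e' e)) ⟩
        iter f (p ∸ m') (iter f m' x) ≡⟨ sym (iter-+ f (p ∸ m') m' x) ⟩
        iter f (p ∸ m' + m') x ≡⟨ cong (λ k → iter f k x) (m∸n+n≡m (<⇒≤ m'<p)) ⟩
        iter f p x ≡⟨ px ⟩
        x ∎)
    where open ≡-Reasoning

  record IsPER (r : X n → X n → Bool) : Set where
    field
      symmetric : ∀ x y → r x y ≡ r y x
      transitive : ∀ x y z → r x y ≡ true → r y z ≡ true → r x z ≡ true
  open IsPER public

  sameOrbit-isPER : (f : X n → X n) → Injective _≡_ _≡_ f → IsPER (sameOrbit f)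
  sameOrbit-isPER f inj = record
    { symmetric = λ x y → true⇔true⇒≡ (s x y) (s y x)
    ; transitive = λ x y z e1 e2 → let (m1 , q1) = sameOrbit-sound f x y e1 ; (m2 , q2) = sameOrbit-sound f y z e2 in
        sameOrbit-complete f inj x z (m2 + m1) (trans (iter-+ f m2 m1 x) (trans (cong (iter f m2) q1) q2))
    }
    where
    s : ∀ x y → sameOrbit f x y ≡ true → sameOrbit f y x ≡ true
    s x y e = let (m , q) = sameOrbit-sound f x y e ; (k , q') = orbit-sym f inj x y m q in sameOrbit-complete f inj y x k q'

  seenRelated : (X n → X n → Bool) → List (X n) → X n → Bool
  seenRelated r seen z = any (λ s → r s z) seen

  classCount : (X n → X n → Bool) → List (X n) → List (X n) → ℕ
  classCount r seen [] = 0
  classCount r seen (x ∷ xs) = if seenRelated r seen x then classCount r (x ∷ seen) xs else suc (classCount r (x ∷ seen) xs)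

  cyclesFrom≡classCount : (f : X n → X n) (seen L : List (X n)) → cyclesFrom f seen L ≡ classCount (sameOrbit f) seen L
  cyclesFrom≡classCount f seen [] = refl
  cyclesFrom≡classCount f seen (x ∷ L) rewrite cyclesFrom≡classCount f (x ∷ seen) L = refl

  classCount-cong-seen : ∀ r s1 s2 L → (∀ z → seenRelated r s1 z ≡ seenRelated r s2 z) → classCount r s1 L ≡ classCount r s2 L
  classCount-cong-seen r s1 s2 [] h = refl
  classCount-cong-seen r s1 s2 (x ∷ xs) h rewrite h x | classCount-cong-seen r (x ∷ s1) (x ∷ s2) xs (λ z → cong (r x z ∨_) (h z)) = refl

  seenRelated-trans : ∀ r → IsPER r → ∀ seen x z → seenRelated r seen x ≡ true → r x z ≡ true → seenRelated r seen z ≡ true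
  seenRelated-trans r E (s ∷ seen) x z e1 e2 with r s x in sx
  ... | true rewrite transitive E s x z sx e2 = refl
  ... | false rewrite seenRelated-trans r E seen x z e1 e2 with r s z
  ... | true = refl
  ... | false = refl

  related-swap : ∀ r → IsPER r → ∀ x y z → r x y ≡ true → r x z ≡ r y z
  related-swap r E x y z e = true⇔true⇒≡ (λ q → transitive E y x z (trans (symmetric E y x) e) q) (λ q → transitive E x y z e q)

  seenRelated-back : ∀ r → IsPER r → ∀ seen x y → r x y ≡ true → seenRelated r seen y ≡ true → seenRelated r seen x ≡ true
  seenRelated-back r E seen x y xy sy = seenRelated-trans r E seen y x sy (trans (symmetric E y x) xy)

  classCount-extend-seen : ∀ r → IsPER r → ∀ seen x ys → seenRelated r seen x ≡ false →
            classCount r seen ys ≡ classCount r (x ∷ seen) ys + (if any (r x) ys then 1 else 0)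
  classCount-extend-seen r E seen x [] h = refl
  classCount-extend-seen r E seen x (y ∷ ys) h with r x y in xy
  ... | true with seenRelated r seen y in sy
  ... | true with trans (sym (seenRelated-back r E seen x y xy sy)) h
  ... | ()
  classCount-extend-seen r E seen x (y ∷ ys) h | true | false =
    trans (cong suc (classCount-cong-seen r (y ∷ seen) (y ∷ x ∷ seen) ys (λ z → trans (∨-duplicateˡ (r y z) _) (cong (λ q → r y z ∨ (q ∨ seenRelated r seen z)) (sym (related-swap r E x y z xy))))))
          (+-comm 1 _)
  classCount-extend-seen r E seen x (y ∷ ys) h | false with classCount-extend-seen r E (y ∷ seen) x ys (trans (cong (_∨ seenRelated r seen x) (trans (symmetric E y x) xy)) h)
  ... | ih with seenRelated r seen y
  ... | true = trans ih (cong (_+ _) (classCount-cong-seen r (x ∷ y ∷ seen) (y ∷ x ∷ seen) ys (λ z → ∨-exchangeˡ (r x z) (r y z) _)))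
  ... | false = cong suc (trans ih (cong (_+ _) (classCount-cong-seen r (x ∷ y ∷ seen) (y ∷ x ∷ seen) ys (λ z → ∨-exchangeˡ (r x z) (r y z) _))))

  remove : X n → List (X n) → List (X n)
  remove x [] = []
  remove x (y ∷ ys) = if y == x then remove x ys else y ∷ remove x ys

  remove-absent : ∀ x ys → x ∉ ys → remove x ys ≡ ys
  remove-absent x [] h = refl
  remove-absent x (y ∷ ys) h with y == x | ==-view y x
  ... | true | isEq refl = ⊥-elim (h (here refl))
  ... | false | isNeq _ = cong (y ∷_) (remove-absent x ys (λ m → h (there m)))

  ∈-remove⁻ : ∀ {z} x ys → z ∈ remove x ys → z ∈ ys × z ≢ x
  ∈-remove⁻ x (y ∷ ys) m with y == x | ==-view y x
  ... | true | isEq _ = let (a , b) = ∈-remove⁻ x ys m in there a , b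
  ... | false | isNeq ne with m
  ... | here refl = here refl , ne
  ... | there m' = let (a , b) = ∈-remove⁻ x ys m' in there a , b

  ∈-remove⁺ : ∀ {z} x ys → z ∈ ys → z ≢ x → z ∈ remove x ys
  ∈-remove⁺ x (y ∷ ys) m ne with y == x | ==-view y x
  ∈-remove⁺ x (y ∷ ys) (here refl) ne | true | isEq e = ⊥-elim (ne e)
  ∈-remove⁺ x (y ∷ ys) (there m) ne | true | isEq e = ∈-remove⁺ x ys m ne
  ∈-remove⁺ x (y ∷ ys) (here refl) ne | false | isNeq _ = here refl
  ∈-remove⁺ x (y ∷ ys) (there m) ne | false | isNeq _ = there (∈-remove⁺ x ys m ne)

  All-remove : ∀ {P : X n → Set} x ys → All P ys → All P (remove x ys)
  All-remove x [] [] = []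
  All-remove x (y ∷ ys) (p ∷ ps) with y == x
  ... | true = All-remove x ys ps
  ... | false = p ∷ All-remove x ys ps

  remove-unique : ∀ x ys → Unique ys → Unique (remove x ys)
  remove-unique x [] u = u
  remove-unique x (y ∷ ys) (a ∷ u) with y == x
  ... | true = remove-unique x ys u
  ... | false = All-remove x ys a ∷ remove-unique x ys u

  classCount-remove : ∀ r → IsPER r → ∀ seen x L → x ∈ L → Unique L →
     classCount r seen L ≡ classCount r seen (remove x L) + (if seenRelated r seen x ∨ any (r x) (remove x L) then 0 else 1)
  classCount-remove r E seen x (.x ∷ ys) (here refl) (a ∷ u) rewrite ==-refl x | remove-absent x ys (All¬⇒¬Any a) with seenRelated r seen x in sx
  ... | true = trans (classCount-cong-seen r (x ∷ seen) seen ys λ z → lem z) (sym (+-identityʳ _))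
    where
    lem : ∀ z → (r x z ∨ seenRelated r seen z) ≡ seenRelated r seen z
    lem z with r x z in xz
    ... | true = sym (seenRelated-trans r E seen x z sx xz)
    ... | false = refl
  ... | false with any (r x) ys in ax | classCount-extend-seen r E seen x ys sx
  ... | true | ih = trans (+-comm 1 _) (trans (sym ih) (sym (+-identityʳ _)))
  ... | false | ih = trans (+-comm 1 _) (cong (_+ 1) (trans (sym (+-identityʳ _)) (sym ih)))
  classCount-remove r E seen x (y ∷ ys) (there m) (a ∷ u) with y == x | ==-view y x
  ... | true | isEq refl = ⊥-elim (All¬⇒¬Any a m)
  ... | false | isNeq ne with classCount-remove r E (y ∷ seen) x ys m u
  ... | ih rewrite symmetric E y x | ∨-exchange-assoc (r x y) (seenRelated r seen x) (any (r x) (remove x ys)) with seenRelated r seen y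
  ... | true = ih
  ... | false = cong suc ih

  classCount-head : ∀ r → IsPER r → ∀ x ys → classCount r [] (x ∷ ys) ≡ classCount r [] ys + (if any (r x) ys then 0 else 1)
  classCount-head r E x ys with any (r x) ys | classCount-extend-seen r E [] x ys refl
  ... | true | ih = trans (+-comm 1 _) (trans (sym ih) (sym (+-identityʳ _)))
  ... | false | ih = trans (+-comm 1 _) (cong (_+ 1) (trans (sym (+-identityʳ _)) (sym ih)))

  classCount-sameElements : ∀ r → IsPER r → ∀ L M → Unique L → Unique M → (∀ z → z ∈ L → z ∈ M) → (∀ z → z ∈ M → z ∈ L) → classCount r [] L ≡ classCount r [] M
  classCount-sameElements r E [] [] _ _ _ _ = refl
  classCount-sameElements r E [] (z ∷ M) _ _ _ h2 with h2 z (here refl)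
  ... | ()
  classCount-sameElements r E (x ∷ ys) M (a ∷ u) uM h1 h2 =
    trans (classCount-head r E x ys)
     (trans (cong₂ _+_ (classCount-sameElements r E ys (remove x M) u (remove-unique x M uM) g1 g2)
                       (cong (λ b → if b then 0 else 1) (any-resp-sameElements (r x) ys (remove x M) g1 g2)))
      (sym (classCount-remove r E [] x M (h1 x (here refl)) uM)))
    where
    g1 : ∀ z → z ∈ ys → z ∈ remove x M
    g1 z m = ∈-remove⁺ x M (h1 z (there m)) (λ e → All.lookup a m (sym e))
    g2 : ∀ z → z ∈ remove x M → z ∈ ys
    g2 z m with ∈-remove⁻ x M m
    ... | m' , ne with h2 z m'
    ... | here e = ⊥-elim (ne e)
    ... | there m'' = m''

  seenRelated-resp : ∀ (G : X n → Set) r r' → (∀ u v → G u → G v → r u v ≡ r' u v) → ∀ x → G x → ∀ s → All G s → seenRelated r s x ≡ seenRelated r' s x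
  seenRelated-resp G r r' h x gx [] [] = refl
  seenRelated-resp G r r' h x gx (s ∷ ss) (g ∷ gg) rewrite h s x g gx | seenRelated-resp G r r' h x gx ss gg = refl

  classCount-resp : ∀ (G : X n → Set) r r' → (∀ u v → G u → G v → r u v ≡ r' u v) → ∀ seen L → All G seen → All G L → classCount r seen L ≡ classCount r' seen L
  classCount-resp G r r' h seen [] gs gL = refl
  classCount-resp G r r' h seen (x ∷ L) gs (gx ∷ gL) rewrite seenRelated-resp G r r' h x gx seen gs | classCount-resp G r r' h (x ∷ seen) L (gx ∷ gs) gL = refl

  seenRelated-map : ∀ (φ : X n → X n) r x s → seenRelated (λ u v → r (φ u) (φ v)) s x ≡ seenRelated r (map φ s) (φ x)
  seenRelated-map φ r x [] = refl
  seenRelated-map φ r x (s ∷ ss) rewrite seenRelated-map φ r x ss = refl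

  classCount-map : ∀ (φ : X n → X n) r seen L → classCount (λ u v → r (φ u) (φ v)) seen L ≡ classCount r (map φ seen) (map φ L)
  classCount-map φ r seen [] = refl
  classCount-map φ r seen (x ∷ L) rewrite seenRelated-map φ r x seen | classCount-map φ r (x ∷ seen) L = refl

  ∈-allX : ∀ (x : X n) → x ∈ allX n
  ∈-allX (inj₁ k) = ∈-++⁺ˡ (∈-map⁺ inj₁ (∈-allFin k))
  ∈-allX (inj₂ k) = ∈-++⁺ʳ (map inj₁ (allFin n)) (∈-map⁺ inj₂ (∈-allFin k))

  allX-unique : Unique (allX n)
  allX-unique = ++⁺ (map⁺ inj₁-inj (allFin⁺ n)) (map⁺ inj₂-inj (allFin⁺ n)) disj
    where
    inj₁-inj : ∀ {a b : Fin n} → _≡_ {A = X n} (inj₁ a) (inj₁ b) → a ≡ b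
    inj₁-inj refl = refl
    inj₂-inj : ∀ {a b : Fin n} → _≡_ {A = X n} (inj₂ a) (inj₂ b) → a ≡ b
    inj₂-inj refl = refl
    disj : ∀ {v} → ¬ (v ∈ map inj₁ (allFin n) × v ∈ map inj₂ (allFin n))
    disj (m1 , m2) with ∈-map⁻ inj₁ m1 | ∈-map⁻ inj₂ m2
    ... | _ , _ , refl | _ , _ , ()

  cycles : (X n → X n) → ℕ
  cycles f = cyclesFrom f [] (allX n)

  cycles-cong : (f g : X n → X n) → (∀ x → f x ≡ g x) → cycles f ≡ cycles g
  cycles-cong f g h = trans (cyclesFrom≡classCount f [] (allX n)) (trans
     (classCount-resp (λ _ → ⊤) (sameOrbit f) (sameOrbit g) (λ u v _ _ → any-cong _ _ (upTo (2 * n)) (λ m → cong (_== v) (iter-cong f g h m u))) [] (allX n) [] (universal (λ _ → tt) _))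
     (sym (cyclesFrom≡classCount g [] (allX n))))

  classCount-discrete : ∀ r seen (L : List (X n)) → Unique L → (∀ u v → u ≢ v → r u v ≡ false) → (∀ z → z ∈ L → seenRelated r seen z ≡ false) → classCount r seen L ≡ length L
  classCount-discrete r seen [] u h hs = refl
  classCount-discrete r seen (x ∷ L) (a ∷ u) h hs rewrite hs x (here refl) = cong suc (classCount-discrete r (x ∷ seen) L u h (λ z m → cvx z m))
    where
    cvx : ∀ z → z ∈ L → (r x z ∨ seenRelated r seen z) ≡ false
    cvx z m rewrite h x z (All.lookup a m) | hs z (there m) = refl

  cycles-id : cycles id ≡ n + n
  cycles-id = trans (cyclesFrom≡classCount id [] (allX n)) (trans (classCount-discrete (sameOrbit id) [] (allX n) allX-unique rid (λ z _ → refl)) lenX)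
    where
    rid : ∀ u v → u ≢ v → sameOrbit id u v ≡ false
    rid u v ne = any-false⁺ (λ m → iter id m u == v) (upTo (2 * n)) (λ m _ → trans (cong (_== v) (iter-fixed u id refl m)) (==-≢ ne))
    lenX : length (allX n) ≡ n + n
    lenX = trans (length-++ (map inj₁ (allFin n))) (cong₂ _+_ (trans (length-map inj₁ (allFin n)) (length-tabulate {A = Fin n} {n = n} id)) (trans (length-map inj₂ (allFin n)) (length-tabulate {A = Fin n} {n = n} id)))

  -- g / x with x kept as a fixed point (del leaves x ↦ g x), so that cycle counts stay meaningful.
  skip : X n → (X n → X n) → X n → X n
  skip x g y = if y == x then x else (if g y == x then g x else g y)

  skip-self : ∀ x g → skip x g x ≡ x
  skip-self x g rewrite ==-refl x = refl

  skip-other : ∀ x g y → y ≢ x → skip x g y ≡ (if g y == x then g x else g y)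
  skip-other x g y ne rewrite ==-≢ ne = refl

  skip-injective : ∀ x g → Injective _≡_ _≡_ g → Injective _≡_ _≡_ (skip x g)
  skip-injective x g inj {y1} {y2} e with y1 == x | ==-view y1 x | y2 == x | ==-view y2 x
  ... | true | isEq p | true | isEq q = trans p (sym q)
  ... | true | isEq p | false | isNeq q with g y2 == x | ==-view (g y2) x
  ...   | true | isEq r = ⊥-elim (q (inj (trans r e)))
  ...   | false | isNeq r = ⊥-elim (r (sym e))
  skip-injective x g inj {y1} {y2} e | false | isNeq p | true | isEq q with g y1 == x | ==-view (g y1) x
  ...   | true | isEq r = ⊥-elim (p (inj (trans r (sym e))))
  ...   | false | isNeq r = ⊥-elim (r e)
  skip-injective x g inj {y1} {y2} e | false | isNeq p | false | isNeq q with g y1 == x | ==-view (g y1) x | g y2 == x | ==-view (g y2) x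
  ... | true | isEq r | true | isEq s = inj (trans r (sym s))
  ... | true | isEq r | false | isNeq s = ⊥-elim (q (sym (inj e)))
  ... | false | isNeq r | true | isEq s = ⊥-elim (p (inj e))
  ... | false | isNeq r | false | isNeq s = inj e

  iter-skip⇒iter : ∀ x g → Injective _≡_ _≡_ g → ∀ u → u ≢ x → ∀ m → (iter (skip x g) m u ≢ x) × ∃ λ k → iter g k u ≡ iter (skip x g) m u
  iter-skip⇒iter x g inj u ne zero = ne , 0 , refl
  iter-skip⇒iter x g inj u ne (suc m) with iter-skip⇒iter x g inj u ne m
  ... | wne , k , e rewrite skip-other x g (iter (skip x g) m u) wne with g (iter (skip x g) m u) == x | ==-view (g (iter (skip x g) m u)) x
  ... | true | isEq p = (λ q → wne (inj (trans p (sym q)))) , suc (suc k) , cong g (trans (cong g e) p)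
  ... | false | isNeq p = p , suc k , cong g e

  iter⇒iter-skip : ∀ x g → Injective _≡_ _≡_ g → ∀ u → u ≢ x → ∀ m →
     (iter g m u ≢ x × ∃ λ k → iter (skip x g) k u ≡ iter g m u) ⊎
     (iter g m u ≡ x × ∃ λ k → (iter (skip x g) k u ≢ x) × g (iter (skip x g) k u) ≡ x)
  iter⇒iter-skip x g inj u ne zero = inj₁ (ne , 0 , refl)
  iter⇒iter-skip x g inj u ne (suc m) with iter⇒iter-skip x g inj u ne m
  ... | inj₁ (zne , k , e) with g (iter g m u) == x | ==-view (g (iter g m u)) x
  ...   | true | isEq p = inj₂ (p , k , subst (_≢ x) (sym e) zne , trans (cong g e) p)
  ...   | false | isNeq p = inj₁ (p , suc k , trans (cong (skip x g) e) (trans (skip-other x g _ zne) (if-f p)))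
    where
    if-f : g (iter g m u) ≢ x → (if g (iter g m u) == x then g x else g (iter g m u)) ≡ g (iter g m u)
    if-f q rewrite ==-≢ q = refl
  iter⇒iter-skip x g inj u ne (suc m) | inj₂ (zx , k , wne , gw) = inj₁ (gxne , suc k , step)
    where
    w = iter (skip x g) k u
    gxne : g (iter g m u) ≢ x
    gxne q = wne (inj (trans gw (sym (trans (cong g (sym zx)) q))))
    step : skip x g w ≡ g (iter g m u)
    step rewrite skip-other x g w wne | gw | ==-refl x = cong g (sym zx)

  iter-skip-self : ∀ (x : X n) (g : X n → X n) m → iter (skip x g) m x ≡ x
  iter-skip-self x g zero = refl
  iter-skip-self x g (suc m) rewrite iter-skip-self x g m = skip-self x g

  sameOrbit-skip : ∀ x g → Injective _≡_ _≡_ g → ∀ u v → u ≢ x → v ≢ x → sameOrbit g u v ≡ sameOrbit (skip x g) u v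
  sameOrbit-skip x g inj u v ux vx = true⇔true⇒≡ to-skip from-skip
    where
    to-skip : sameOrbit g u v ≡ true → sameOrbit (skip x g) u v ≡ true
    to-skip e with sameOrbit-sound g u v e
    ... | m , q with iter⇒iter-skip x g inj u ux m
    ... | inj₁ (_ , k , e') = sameOrbit-complete (skip x g) (skip-injective x g inj) u v k (trans e' q)
    ... | inj₂ (zx , _) = ⊥-elim (vx (trans (sym q) zx))
    from-skip : sameOrbit (skip x g) u v ≡ true → sameOrbit g u v ≡ true
    from-skip e with sameOrbit-sound (skip x g) u v e
    ... | m , q with iter-skip⇒iter x g inj u ux m
    ... | _ , k , e' = sameOrbit-complete g inj u v k (trans e' q)

  cycles-skip : ∀ g → Injective _≡_ _≡_ g → ∀ x → cycles g + 1 ≡ cycles (skip x g) + indicator (g x == x)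
  -- The orbit of x under g is {x} exactly when x is fixed, while under skip x g it always is.
  cycles-skip g inj x = begin
      cycles g + 1 ≡⟨ cong (_+ 1) (cyclesFrom≡classCount g [] (allX n)) ⟩
      classCount r [] (allX n) + 1 ≡⟨ cong (_+ 1) (classCount-remove r Er [] x (allX n) (∈-allX x) allX-unique) ⟩
      (classCount r [] L' + x-alone) + 1 ≡⟨ cong (λ k → (k + x-alone) + 1) (classCount-resp (_≢ x) r r' (λ u v gu gv → sameOrbit-skip x g inj u v gu gv) [] L' [] L'-≢) ⟩
      (classCount r' [] L' + x-alone) + 1 ≡⟨ alone⇔fixed ⟩
      (classCount r' [] L' + 1) + indicator (g x == x) ≡⟨ cong (_+ indicator (g x == x)) (sym x-alone-after-skip) ⟩
      classCount r' [] (allX n) + indicator (g x == x) ≡⟨ cong (_+ indicator (g x == x)) (sym (cyclesFrom≡classCount (skip x g) [] (allX n))) ⟩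
      cycles (skip x g) + indicator (g x == x) ∎
    where
    open ≡-Reasoning
    r = sameOrbit g
    r' = sameOrbit (skip x g)
    Er = sameOrbit-isPER g inj
    Er' = sameOrbit-isPER (skip x g) (skip-injective x g inj)
    L' = remove x (allX n)
    x-alone = if false ∨ any (r x) L' then 0 else 1
    all-≢ : ∀ (M : List (X n)) → All (_≢ x) (remove x M)
    all-≢ [] = []
    all-≢ (y ∷ M) with y == x | ==-view y x
    ... | true | _ = all-≢ M
    ... | false | isNeq p = p ∷ all-≢ M
    L'-≢ : All (_≢ x) L'
    L'-≢ = all-≢ (allX n)
    skipped⇒unrelated : ∀ v → v ∈ L' → r' x v ≡ false
    skipped⇒unrelated v m with r' x v in e
    ... | false = refl
    ... | true with sameOrbit-sound (skip x g) x v e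
    ... | k , q = ⊥-elim (proj₂ (∈-remove⁻ x (allX n) m) (trans (sym q) (iter-skip-self x g k)))
    fixed⇒unrelated : g x ≡ x → ∀ v → v ∈ L' → r x v ≡ false
    fixed⇒unrelated p v m with r x v in e
    ... | false = refl
    ... | true with sameOrbit-sound g x v e
    ... | k , q = ⊥-elim (proj₂ (∈-remove⁻ x (allX n) m) (trans (sym q) (iter-fixed x g p k)))
    x-alone-after-skip : classCount r' [] (allX n) ≡ classCount r' [] L' + 1
    x-alone-after-skip rewrite classCount-remove r' Er' [] x (allX n) (∈-allX x) allX-unique | any-false⁺ (r' x) L' skipped⇒unrelated = refl
    alone⇔fixed : (classCount r' [] L' + x-alone) + 1 ≡ (classCount r' [] L' + 1) + indicator (g x == x)
    alone⇔fixed with g x == x | ==-view (g x) x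
    ... | true | isEq p rewrite any-false⁺ (r x) L' (λ v m → fixed⇒unrelated p v m) = refl
    ... | false | isNeq p rewrite any-true⁺ (r x) L' (∈-remove⁺ x (allX n) (∈-allX (g x)) p) (sameOrbit-complete g inj x (g x) 1 refl) = trans (cong (_+ 1) (+-identityʳ _)) (sym (+-identityʳ _))

  cycles-skip₂ : ∀ g → Injective _≡_ _≡_ g → ∀ x y →
    cycles g + 2 ≡ cycles (skip y (skip x g)) + (indicator (g x == x) + indicator (skip x g y == y))
  cycles-skip₂ g inj x y = begin
    cycles g + 2                    ≡⟨ +-assoc (cycles g) 1 1 ⟨
    (cycles g + 1) + 1              ≡⟨ cong (_+ 1) (cycles-skip g inj x) ⟩
    (cycles g′ + δx) + 1            ≡⟨ xy∙z≈xz∙y (cycles g′) δx 1 ⟩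
    (cycles g′ + 1) + δx            ≡⟨ cong (_+ δx) (cycles-skip g′ (skip-injective x g inj) y) ⟩
    (cycles (skip y g′) + δy) + δx  ≡⟨ xy∙z≈x∙zy (cycles (skip y g′)) δy δx ⟩
    cycles (skip y g′) + (δx + δy)  ∎
    where
    open ≡-Reasoning
    g′ = skip x g
    δx = indicator (g x == x)
    δy = indicator (g′ y == y)

  module Conjugation (φ : X n → X n) (inv : ∀ y → φ (φ y) ≡ y) where
    φ-inj : Injective _≡_ _≡_ φ
    φ-inj {a} {b} e = trans (sym (inv a)) (trans (cong φ e) (inv b))

    iter-conjugate : ∀ g m u → iter (λ y → φ (g (φ y))) m u ≡ φ (iter g m (φ u))
    iter-conjugate g zero u = sym (inv u)
    iter-conjugate g (suc m) u rewrite iter-conjugate g m u | inv (iter g m (φ u)) = refl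

    φ== : ∀ a v → (φ a == v) ≡ (a == φ v)
    φ== a v = true⇔true⇒≡ (λ e → ≡⇒== (trans (sym (inv a)) (cong φ (==-≡ e)))) (λ e → ≡⇒== (trans (cong φ (==-≡ e)) (inv v)))

    cycles-conjugate : ∀ g → Injective _≡_ _≡_ g → cycles (λ y → φ (g (φ y))) ≡ cycles g
    cycles-conjugate g inj = begin
      cycles g' ≡⟨ cyclesFrom≡classCount g' [] (allX n) ⟩
      classCount (sameOrbit g') [] (allX n) ≡⟨ classCount-resp (λ _ → ⊤) _ _ (λ u v _ _ → rel u v) [] (allX n) [] (universal (λ _ → tt) _) ⟩
      classCount (λ u v → sameOrbit g (φ u) (φ v)) [] (allX n) ≡⟨ classCount-map φ (sameOrbit g) [] (allX n) ⟩
      classCount (sameOrbit g) [] (map φ (allX n)) ≡⟨ classCount-sameElements (sameOrbit g) (sameOrbit-isPER g inj) (map φ (allX n)) (allX n) (map⁺ φ-inj allX-unique) allX-unique (λ z _ → ∈-allX z) (λ z _ → subst (_∈ map φ (allX n)) (inv z) (∈-map⁺ φ (∈-allX (φ z)))) ⟩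
      classCount (sameOrbit g) [] (allX n) ≡⟨ sym (cyclesFrom≡classCount g [] (allX n)) ⟩
      cycles g ∎
      where
      open ≡-Reasoning
      g' = λ y → φ (g (φ y))
      rel : ∀ u v → sameOrbit g' u v ≡ sameOrbit g (φ u) (φ v)
      rel u v = any-cong _ _ (upTo (2 * n)) (λ m → trans (cong (_== v) (iter-conjugate g m u)) (φ== (iter g m (φ u)) v))

-- Permutations of the live points and the reductions
module _ {n : ℕ} where

  infixl 6 _∖_
  _∖_ : (X n → Bool) → X n → X n → Bool
  (D ∖ x) z = D z ∧ not (z == x)

  ∖-intro : ∀ (D : X n → Bool) x z → D z ≡ true → z ≢ x → (D ∖ x) z ≡ true
  ∖-intro D x z d ne rewrite d | ==-≢ ne = refl

  ∖-base : ∀ (D : X n → Bool) x z → (D ∖ x) z ≡ true → D z ≡ true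
  ∖-base D x z e with D z
  ... | true = refl
  ... | false = e

  ∖-≢ : ∀ (D : X n → Bool) x z → (D ∖ x) z ≡ true → z ≢ x
  ∖-≢ D x z e refl with () ← trans (sym (∧-zeroʳ (D z))) (trans (cong (λ b → D z ∧ not b) (sym (==-refl z))) e)

  record PermOn (D : X n → Bool) (P : Perm n) : Set where
    field
      fwd-closed : ∀ y → D y ≡ true → D (fwd P y) ≡ true
      bwd-closed : ∀ y → D y ≡ true → D (bwd P y) ≡ true
      fwd-bwd : ∀ y → D y ≡ true → fwd P (bwd P y) ≡ y
      bwd-fwd : ∀ y → D y ≡ true → bwd P (fwd P y) ≡ y
  open PermOn public

  inverse : Perm n → Perm n
  inverse P = perm (bwd P) (fwd P)

  PermOn-inverse : ∀ {D P} → PermOn D P → PermOn D (inverse P)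
  PermOn-inverse h = record { fwd-closed = bwd-closed h ; bwd-closed = fwd-closed h ; fwd-bwd = bwd-fwd h ; bwd-fwd = fwd-bwd h }

  PermOn-resp : ∀ {D D' P} → (∀ z → D z ≡ D' z) → PermOn D P → PermOn D' P
  PermOn-resp {D} {D'} {P} e h = record
    { fwd-closed = λ y d → trans (sym (e (fwd P y))) (fwd-closed h y (trans (e y) d))
    ; bwd-closed = λ y d → trans (sym (e (bwd P y))) (bwd-closed h y (trans (e y) d))
    ; fwd-bwd = λ y d → fwd-bwd h y (trans (e y) d)
    ; bwd-fwd = λ y d → bwd-fwd h y (trans (e y) d) }

  del-closed : ∀ {D P} x → PermOn D P → D x ≡ true → ∀ y → (D ∖ x) y ≡ true → (D ∖ x) (fwd (del x P) y) ≡ true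
  del-closed {D} {P} x h dx y dy with fwd P y == x | ==-view (fwd P y) x
  ... | true | isEq p = ∖-intro D x (fwd P x) (fwd-closed h x dx) (λ q → ∖-≢ D x y dy (trans (sym (bwd-fwd h y (∖-base D x y dy))) (trans (cong (bwd P) (trans p (sym q))) (bwd-fwd h x dx))))
  ... | false | isNeq p = ∖-intro D x (fwd P y) (fwd-closed h y (∖-base D x y dy)) p

  del-fwd-bwd : ∀ {D P} x → PermOn D P → D x ≡ true → ∀ y → (D ∖ x) y ≡ true → fwd (del x P) (bwd (del x P) y) ≡ y
  del-fwd-bwd {D} {P} x h dx y dy with bwd P y == x | ==-view (bwd P y) x
  ... | true | isEq p rewrite fwd-bwd h x dx | ==-refl x = trans (cong (fwd P) (sym p)) (fwd-bwd h y (∖-base D x y dy))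
  ... | false | isNeq p rewrite fwd-bwd h y (∖-base D x y dy) | ==-≢ (∖-≢ D x y dy) = refl

  PermOn-del : ∀ {D P} x → PermOn D P → D x ≡ true → PermOn (D ∖ x) (del x P)
  PermOn-del {D} {P} x h dx = record
    { fwd-closed = del-closed x h dx
    ; bwd-closed = del-closed {P = inverse P} x (PermOn-inverse h) dx
    ; fwd-bwd = del-fwd-bwd x h dx
    ; bwd-fwd = del-fwd-bwd {P = inverse P} x (PermOn-inverse h) dx }

  PermOn-· : ∀ {D P C} → PermOn D P → PermOn D C → PermOn D (P · C)
  PermOn-· {D} {P} {C} hp hc = record
    { fwd-closed = λ y d → fwd-closed hc _ (fwd-closed hp y d)
    ; bwd-closed = λ y d → bwd-closed hp _ (bwd-closed hc y d)
    ; fwd-bwd = λ y d → trans (cong (fwd C) (fwd-bwd hp _ (bwd-closed hc y d))) (fwd-bwd hc y d)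
    ; bwd-fwd = λ y d → trans (cong (bwd P) (bwd-fwd hc _ (fwd-closed hp y d))) (bwd-fwd hp y d) }

  swapF-closed : ∀ (D : X n → Bool) x y → D x ≡ true → D y ≡ true → ∀ w → D w ≡ true → D (swapF x y w) ≡ true
  swapF-closed D x y dx dy w dw with w == x
  ... | true = dy
  ... | false with w == y
  ... | true = dx
  ... | false = dw

  swapF-involutive : ∀ (x y w : X n) → swapF x y (swapF x y w) ≡ w
  swapF-involutive x y w with w == x | ==-view w x
  ... | true | isEq refl with y == w | ==-view y w
  ...   | true | isEq refl = refl
  ...   | false | isNeq _ rewrite ==-refl y = refl
  swapF-involutive x y w | false | isNeq p with w == y | ==-view w y
  ... | true | isEq refl rewrite ==-refl x = refl
  ... | false | isNeq q rewrite ==-≢ p | ==-≢ q = refl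

  PermOn-tr : ∀ (D : X n → Bool) x y → D x ≡ true → D y ≡ true → PermOn D (tr x y)
  PermOn-tr D x y dx dy = record
    { fwd-closed = swapF-closed D x y dx dy ; bwd-closed = swapF-closed D x y dx dy
    ; fwd-bwd = λ w _ → swapF-involutive x y w ; bwd-fwd = λ w _ → swapF-involutive x y w }

  cyc3F-closed : ∀ (D : X n → Bool) x y z → D x ≡ true → D y ≡ true → D z ≡ true → ∀ w → D w ≡ true → D (cyc3F x y z w) ≡ true
  cyc3F-closed D x y z dx dy dz w dw with w == x
  ... | true = dy
  ... | false with w == y
  ... | true = dz
  ... | false with w == z
  ... | true = dx
  ... | false = dw

  cyc3F-inverse : ∀ (x y z : X n) → x ≢ y → y ≢ z → x ≢ z → ∀ w → cyc3F x z y (cyc3F x y z w) ≡ w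
  cyc3F-inverse x y z xy yz xz w with w == x | ==-view w x
  ... | true | isEq refl rewrite ==-≢ (λ e → xy (sym e)) | ==-≢ yz | ==-refl y = refl
  ... | false | isNeq p with w == y | ==-view w y
  ...   | true | isEq refl rewrite ==-≢ (λ e → xz (sym e)) | ==-≢ (λ e → yz (sym e)) | ==-refl z = refl
  ...   | false | isNeq q with w == z | ==-view w z
  ...     | true | isEq r rewrite ==-refl x = sym r
  ...     | false | isNeq r rewrite ==-≢ p | ==-≢ r | ==-≢ q = refl

  PermOn-c3 : ∀ (D : X n → Bool) x y z → D x ≡ true → D y ≡ true → D z ≡ true → x ≢ y → y ≢ z → x ≢ z → PermOn D (c3 x y z)
  PermOn-c3 D x y z dx dy dz xy yz xz = record
    { fwd-closed = cyc3F-closed D x y z dx dy dz ; bwd-closed = cyc3F-closed D x z y dx dz dy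
    ; fwd-bwd = λ w _ → cyc3F-inverse x z y (λ e → xz e) (λ e → yz (sym e)) xy w
    ; bwd-fwd = λ w _ → cyc3F-inverse x y z xy yz xz w }

  swapF-first : ∀ (x y : X n) → swapF x y x ≡ y
  swapF-first x y rewrite ==-refl x = refl
  swapF-second : ∀ (x y : X n) → y ≢ x → swapF x y y ≡ x
  swapF-second x y ne rewrite ==-≢ ne | ==-refl y = refl
  swapF-other : ∀ (x y z : X n) → z ≢ x → z ≢ y → swapF x y z ≡ z
  swapF-other x y z p q rewrite ==-≢ p | ==-≢ q = refl

  cyc3F-first : ∀ (x y z : X n) → cyc3F x y z x ≡ y
  cyc3F-first x y z rewrite ==-refl x = refl
  cyc3F-second : ∀ (x y z : X n) → y ≢ x → cyc3F x y z y ≡ z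
  cyc3F-second x y z p rewrite ==-≢ p | ==-refl y = refl
  cyc3F-third : ∀ (x y z : X n) → z ≢ x → z ≢ y → cyc3F x y z z ≡ x
  cyc3F-third x y z p q rewrite ==-≢ p | ==-≢ q | ==-refl z = refl
  cyc3F-other : ∀ (x y z w : X n) → w ≢ x → w ≢ y → w ≢ z → cyc3F x y z w ≡ w
  cyc3F-other x y z w p q r rewrite ==-≢ p | ==-≢ q | ==-≢ r = refl

  X-split : (x y : X n) → (x ≡ y) ⊎ (x ≢ y)
  X-split x y with x == y | ==-view x y
  ... | true | isEq p = inj₁ p
  ... | false | isNeq p = inj₂ p

  PermOn-injective : ∀ {D P} → PermOn D P → ∀ {y z : X n} → D y ≡ true → D z ≡ true → fwd P y ≡ fwd P z → y ≡ z
  PermOn-injective {P = P} h {y} {z} dy dz e = trans (sym (bwd-fwd h y dy)) (trans (cong (bwd P) e) (bwd-fwd h z dz))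

  label : X n → Fin n
  label (inj₁ k) = k
  label (inj₂ k) = k

  live : List (Fin n) → X n → Bool
  live bs x = label x ∈ᵇ bs

  module ReductionA (D : X n → Bool) (P : Perm n) (h : PermOn D P) (a b : Fin n)
              (dA : D (inj₁ a) ≡ true) (dB : D (inj₁ b) ≡ true) (ab : _≢_ {A = X n} (inj₁ a) (inj₁ b)) where
    A B PB : X n
    A = inj₁ a
    B = inj₁ b
    PB = fwd P B
    dPB : D PB ≡ true
    dPB = fwd-closed h B dB

    redA-fixed : PB ≡ B → redA P a b ≡ del B P
    redA-fixed p = if-true (≡⇒== p)
    redA-adjacent : PB ≢ B → A ≡ PB → redA P a b ≡ del B (P · tr B A)
    redA-adjacent p q = trans (if-false (==-≢ p)) (if-true (≡⇒== q))
    redA-generic : PB ≢ B → A ≢ PB → redA P a b ≡ del B (P · c3 B A PB)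
    redA-generic p q = trans (if-false (==-≢ p)) (if-false (==-≢ q))

    PermOn-redA : PermOn (D ∖ B) (redA P a b)
    PermOn-redA with X-split PB B
    ... | inj₁ p = subst (PermOn (D ∖ B)) (sym (redA-fixed p)) (PermOn-del B h dB)
    ... | inj₂ p with X-split A PB
    ...   | inj₁ q = subst (PermOn (D ∖ B)) (sym (redA-adjacent p q)) (PermOn-del B (PermOn-· h (PermOn-tr D B A dB dA)) dB)
    ...   | inj₂ q = subst (PermOn (D ∖ B)) (sym (redA-generic p q)) (PermOn-del B (PermOn-· h (PermOn-c3 D B A PB dB dA dPB (λ e → ab (sym e)) q (λ e → p (sym e)))) dB)

    relabelA : X n → X n
    relabelA z = if PB == B then z else (if z == B then A else (if z == A then PB else z))

    redA-char : ∀ y → (D ∖ B) y ≡ true → fwd (redA P a b) y ≡ relabelA (fwd P y)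
    redA-char y dy with X-split PB B
    ... | inj₁ p = trans (cong (λ Q → fwd Q y) (redA-fixed p)) (trans (if-false (==-≢ {x = fwd P y} {y = B} (λ e → ∖-≢ D B y dy (PermOn-injective h (∖-base D B y dy) dB (trans e (sym p)))))) (sym (if-true (≡⇒== p))))
    ... | inj₂ p with X-split A PB
    ...   | inj₁ q = trans (cong (λ Q → fwd Q y) (redA-adjacent p q)) (trans goal2 (sym (if-false (==-≢ p))))
      where
      dy' = ∖-base D B y dy
      yB = ∖-≢ D B y dy
      goal2 : (if swapF B A (fwd P y) == B then swapF B A PB else swapF B A (fwd P y)) ≡ (if fwd P y == B then A else (if fwd P y == A then PB else fwd P y))
      goal2 with X-split (fwd P y) B
      ... | inj₁ r = let e = trans (cong (swapF B A) r) (swapF-first B A) in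
            trans (cong (λ v → if v == B then swapF B A PB else v) e) (trans (if-false (==-≢ ab)) (sym (trans (if-true (≡⇒== r)) refl)))
      ... | inj₂ r with X-split (fwd P y) A
      ...   | inj₁ s = ⊥-elim (yB (PermOn-injective h dy' dB (trans s q)))
      ...   | inj₂ s = let e = swapF-other B A (fwd P y) r s in
            trans (cong (λ v → if v == B then swapF B A PB else v) e) (trans (if-false (==-≢ r)) (sym (trans (if-false (==-≢ r)) (if-false (==-≢ s)))))
    ...   | inj₂ q = trans (cong (λ Q → fwd Q y) (redA-generic p q)) (trans goal3 (sym (if-false (==-≢ p))))
      where
      dy' = ∖-base D B y dy
      yB = ∖-≢ D B y dy
      goal3 : (if cyc3F B A PB (fwd P y) == B then cyc3F B A PB PB else cyc3F B A PB (fwd P y)) ≡ (if fwd P y == B then A else (if fwd P y == A then PB else fwd P y))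
      goal3 with X-split (fwd P y) B
      ... | inj₁ r = let e = trans (cong (cyc3F B A PB) r) (cyc3F-first B A PB) in
            trans (cong (λ v → if v == B then cyc3F B A PB PB else v) e) (trans (if-false (==-≢ ab)) (sym (if-true (≡⇒== r))))
      ... | inj₂ r with X-split (fwd P y) A
      ...   | inj₁ s = let e = trans (cong (cyc3F B A PB) s) (cyc3F-second B A PB ab) in
            trans (cong (λ v → if v == B then cyc3F B A PB PB else v) e) (trans (if-false (==-≢ p)) (sym (trans (if-false (==-≢ r)) (if-true (≡⇒== s)))))
      ...   | inj₂ s = let e = cyc3F-other B A PB (fwd P y) r s (λ e → yB (PermOn-injective h dy' dB e)) in
            trans (cong (λ v → if v == B then cyc3F B A PB PB else v) e) (trans (if-false (==-≢ r)) (sym (trans (if-false (==-≢ r)) (if-false (==-≢ s)))))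

  redAθ′ : Perm n → Fin n → Fin n → Perm n
  redAθ′ R a b =
    let tA = θ (inj₁ a) ; tB = θ (inj₁ b) ; u = bwd R tB in
    if u == tB then del tB R
    else (if tA == u then del tB (tr tB tA · R)
          else del tB (c3 tA tB u · R))

  module ReductionAθ (R : Perm n) (a b : Fin n) (D1 : X n → Bool) (h1 : PermOn D1 R)
               (dtA : D1 (inj₂ a) ≡ true) (dtB : D1 (inj₂ b) ≡ true) (ab : _≢_ {A = X n} (inj₂ a) (inj₂ b)) where
    tA tB u : X n
    tA = inj₂ a
    tB = inj₂ b
    u = bwd R tB
    du : D1 u ≡ true
    du = bwd-closed h1 tB dtB
    Ru : fwd R u ≡ tB
    Ru = fwd-bwd h1 tB dtB

    redAθ′-fixed : u ≡ tB → redAθ′ R a b ≡ del tB R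
    redAθ′-fixed p = if-true (≡⇒== p)
    redAθ′-adjacent : u ≢ tB → tA ≡ u → redAθ′ R a b ≡ del tB (tr tB tA · R)
    redAθ′-adjacent p q = trans (if-false (==-≢ p)) (if-true (≡⇒== q))
    redAθ′-generic : u ≢ tB → tA ≢ u → redAθ′ R a b ≡ del tB (c3 tA tB u · R)
    redAθ′-generic p q = trans (if-false (==-≢ p)) (if-false (==-≢ q))

    PermOn-redAθ′ : PermOn (D1 ∖ tB) (redAθ′ R a b)
    PermOn-redAθ′ with X-split u tB
    ... | inj₁ p = subst (PermOn (D1 ∖ tB)) (sym (redAθ′-fixed p)) (PermOn-del tB h1 dtB)
    ... | inj₂ p with X-split tA u
    ...   | inj₁ q = subst (PermOn (D1 ∖ tB)) (sym (redAθ′-adjacent p q)) (PermOn-del tB (PermOn-· (PermOn-tr D1 tB tA dtB dtA) h1) dtB)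
    ...   | inj₂ q = subst (PermOn (D1 ∖ tB)) (sym (redAθ′-generic p q)) (PermOn-del tB (PermOn-· (PermOn-c3 D1 tA tB u dtA dtB du ab (λ e → p (sym e)) q) h1) dtB)

    Rne : ∀ y → D1 y ≡ true → y ≢ u → fwd R y ≢ tB
    Rne y dy ne e = ne (PermOn-injective h1 dy du (trans e (sym Ru)))

    charθ : X n → X n
    charθ y = if u == tB then fwd R y else (if y == tA then fwd R tB else (if y == u then fwd R tA else fwd R y))

    redAθ′-char : ∀ y → (D1 ∖ tB) y ≡ true → fwd (redAθ′ R a b) y ≡ charθ y
    redAθ′-char y dy with X-split u tB
    ... | inj₁ p = trans (cong (λ Q → fwd Q y) (redAθ′-fixed p)) (trans (if-false (==-≢ (Rne y dy' (λ e → yB (trans e p))))) (sym (if-true (≡⇒== p))))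
      where dy' = ∖-base D1 tB y dy
            yB = ∖-≢ D1 tB y dy
    ... | inj₂ p with X-split tA u
    ...   | inj₁ q = trans (cong (λ Q → fwd Q y) (redAθ′-adjacent p q)) (trans gβ (sym (if-false (==-≢ p))))
      where
      dy' = ∖-base D1 tB y dy
      yB = ∖-≢ D1 tB y dy
      RtB : fwd R tB ≢ tB
      RtB = Rne tB dtB (λ e → p (sym e))
      gβ : (if fwd R (swapF tB tA y) == tB then fwd R (swapF tB tA tB) else fwd R (swapF tB tA y)) ≡ (if y == tA then fwd R tB else (if y == u then fwd R tA else fwd R y))
      gβ with X-split y tA
      ... | inj₁ r = let e = trans (cong (λ v → fwd R (swapF tB tA v)) r) (cong (fwd R) (swapF-second tB tA ab)) in
            trans (cong (λ v → if v == tB then fwd R (swapF tB tA tB) else v) e) (trans (if-false (==-≢ RtB)) (sym (if-true (≡⇒== r))))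
      ... | inj₂ r = let e = cong (fwd R) (swapF-other tB tA y yB r) ; ne = Rne y dy' (λ e → r (trans e (sym q))) in
            trans (cong (λ v → if v == tB then fwd R (swapF tB tA tB) else v) e) (trans (if-false (==-≢ ne)) (sym (trans (if-false (==-≢ r)) (if-false (==-≢ (λ e → r (trans e (sym q))))))))
    ...   | inj₂ q = trans (cong (λ Q → fwd Q y) (redAθ′-generic p q)) (trans gγ (sym (if-false (==-≢ p))))
      where
      dy' = ∖-base D1 tB y dy
      yB = ∖-≢ D1 tB y dy
      RtB : fwd R tB ≢ tB
      RtB = Rne tB dtB (λ e → p (sym e))
      gγ : (if fwd R (cyc3F tA tB u y) == tB then fwd R (cyc3F tA tB u tB) else fwd R (cyc3F tA tB u y)) ≡ (if y == tA then fwd R tB else (if y == u then fwd R tA else fwd R y))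
      gγ with X-split y tA
      ... | inj₁ r = let e = trans (cong (λ v → fwd R (cyc3F tA tB u v)) r) (cong (fwd R) (cyc3F-first tA tB u)) in
            trans (cong (λ v → if v == tB then fwd R (cyc3F tA tB u tB) else v) e) (trans (if-false (==-≢ RtB)) (sym (if-true (≡⇒== r))))
      ... | inj₂ r with X-split y u
      ...   | inj₁ s = let e = trans (cong (λ v → fwd R (cyc3F tA tB u v)) s) (cong (fwd R) (cyc3F-third tA tB u (λ e → q (sym e)) p)) ; ne = Rne tA dtA q in
            trans (cong (λ v → if v == tB then fwd R (cyc3F tA tB u tB) else v) e) (trans (if-false (==-≢ ne)) (sym (trans (if-false (==-≢ r)) (if-true (≡⇒== s)))))
      ...   | inj₂ s = let e = cong (fwd R) (cyc3F-other tA tB u y r yB s) ; ne = Rne y dy' s in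
            trans (cong (λ v → if v == tB then fwd R (cyc3F tA tB u tB) else v) e) (trans (if-false (==-≢ ne)) (sym (trans (if-false (==-≢ r)) (if-false (==-≢ s)))))

-- Partial embeddings and insertion
module _ {n : ℕ} where

  -- An embedding on the live points D, extended by the identity; Qi is its inverse.
  record PartialEmbedding (D : X n → Bool) (Q Qi : X n → X n) : Set where
    field
      fixes-dead : ∀ z → D z ≡ false → Q z ≡ z
      live-closed : ∀ z → D z ≡ true → D (Q z) ≡ true
      leftInverse : ∀ z → Qi (Q z) ≡ z
      rightInverse : ∀ z → Q (Qi z) ≡ z
      maps-S : ∀ k → ∃ λ l → Q (inj₁ k) ≡ inj₁ l
      maps-Sθ : ∀ k → ∃ λ l → Q (inj₂ k) ≡ inj₂ l
      reverses : ∀ k → Q (θ (Q (inj₁ k))) ≡ θ (inj₁ k)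
  open PartialEmbedding public

  PE-injective : ∀ {D Q Qi} → PartialEmbedding D Q Qi → ∀ {y z} → Q y ≡ Q z → y ≡ z
  PE-injective {Qi = Qi} h {y} {z} e = trans (sym (leftInverse h y)) (trans (cong Qi e) (leftInverse h z))

  PE-dead-preimage : ∀ {D Q Qi} → PartialEmbedding D Q Qi → ∀ d z → D d ≡ false → Q z ≡ d → z ≡ d
  PE-dead-preimage {D} {Q} h d z dd e with D z in dz
  ... | true with () ← trans (sym (live-closed h z dz)) (trans (cong D e) dd)
  ... | false = trans (sym (fixes-dead h z dz)) e

  PE-==-dead : ∀ {D Q Qi} → PartialEmbedding D Q Qi → ∀ d z → D d ≡ false → (Q z == d) ≡ (z == d)
  PE-==-dead {D} {Q} h d z dd = true⇔true⇒≡ (λ e → ≡⇒== (PE-dead-preimage h d z dd (==-≡ e))) (λ e → ≡⇒== (trans (cong Q (==-≡ e)) (fixes-dead h d dd)))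

  S≢T : ∀ {k l : Fin n} → _≢_ {A = X n} (inj₁ k) (inj₂ l)
  S≢T ()
  T≢S : ∀ {k l : Fin n} → _≢_ {A = X n} (inj₂ k) (inj₁ l)
  T≢S ()

  -- Puts b into the cycle of Q right after a, and θb into the reverse cycle right before θa.
  insert : Fin n → Fin n → (X n → X n) → X n → X n
  insert a b Q z = if z == inj₁ a then inj₁ b else (if z == inj₁ b then Q (inj₁ a) else (if z == inj₂ b then inj₂ a else (if z == θ (Q (inj₁ a)) then inj₂ b else Q z)))

  insertInv : Fin n → Fin n → (X n → X n) → (X n → X n) → X n → X n
  insertInv a b Q Qi w = if w == inj₁ b then inj₁ a else (if w == Q (inj₁ a) then inj₁ b else (if w == inj₂ a then inj₂ b else (if w == inj₂ b then θ (Q (inj₁ a)) else Qi w)))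

  θ-involutive : ∀ (x : X n) → θ (θ x) ≡ x
  θ-involutive (inj₁ _) = refl
  θ-involutive (inj₂ _) = refl

  θ-injective : ∀ {x y : X n} → θ x ≡ θ y → x ≡ y
  θ-injective {x} {y} e = trans (sym (θ-involutive x)) (trans (cong θ e) (θ-involutive y))

  module Insertion (D D' : X n → Bool) (Q Qi : X n → X n) (hq : PartialEmbedding D' Q Qi) (a b : Fin n)
             (D'≡ : ∀ z → D' z ≡ ((D ∖ inj₁ b) ∖ inj₂ b) z)
             (dB : D (inj₁ b) ≡ true) (dtB : D (inj₂ b) ≡ true)
             (dA : D' (inj₁ a) ≡ true) (θcl : ∀ z → D' (θ z) ≡ D' z) where
    A B tA tB c : X n
    A = inj₁ a
    B = inj₁ b
    tA = inj₂ a
    tB = inj₂ b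
    c = Q A

    D'→D : ∀ z → D' z ≡ true → D z ≡ true
    D'→D z e = ∖-base D (inj₁ b) z (∖-base (D ∖ inj₁ b) (inj₂ b) z (trans (sym (D'≡ z)) e))
    D'→B : ∀ z → D' z ≡ true → z ≢ B
    D'→B z e = ∖-≢ D (inj₁ b) z (∖-base (D ∖ inj₁ b) (inj₂ b) z (trans (sym (D'≡ z)) e))
    D'→tB : ∀ z → D' z ≡ true → z ≢ tB
    D'→tB z e = ∖-≢ (D ∖ inj₁ b) (inj₂ b) z (trans (sym (D'≡ z)) e)
    D→D' : ∀ z → D z ≡ true → z ≢ B → z ≢ tB → D' z ≡ true
    D→D' z d p q = trans (D'≡ z) (∖-intro (D ∖ B) tB z (∖-intro D B z d p) q)
    D'B : D' B ≡ false
    D'B with D' B in e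
    ... | true = ⊥-elim (D'→B B e refl)
    ... | false = refl
    D'tB : D' tB ≡ false
    D'tB with D' tB in e
    ... | true = ⊥-elim (D'→tB tB e refl)
    ... | false = refl

    AB : A ≢ B
    AB e = D'→B A dA e
    dtA : D' tA ≡ true
    dtA = trans (θcl A) dA
    dc : D' c ≡ true
    dc = live-closed hq A dA
    dθc : D' (θ c) ≡ true
    dθc = trans (θcl c) dc
    cl : ∃ λ l → c ≡ inj₁ l
    cl = maps-S hq a
    cS : ∀ {k} → c ≢ inj₂ k
    cS {k} e with cl
    ... | l , q = S≢T (trans (sym q) e)
    θcT : ∀ {k} → θ c ≢ inj₁ k
    θcT {k} e with cl
    ... | l , q = T≢S (trans (sym (cong θ q)) e)
    cB : c ≢ B
    cB e = D'→B c dc e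
    θctB : θ c ≢ tB
    θctB e = cB (θ-injective e)
    Qθc : Q (θ c) ≡ tA
    Qθc = reverses hq a
    tAtB : tA ≢ tB
    tAtB e = AB (θ-injective e)

    ins-A : insert a b Q A ≡ B
    ins-A = if-true (==-refl A)
    ins-B : insert a b Q B ≡ c
    ins-B = trans (if-false (==-≢ (λ e → AB (sym e)))) (if-true (==-refl B))
    ins-tB : insert a b Q tB ≡ tA
    ins-tB = if-true (==-refl tB)
    ins-θc : insert a b Q (θ c) ≡ tB
    ins-θc = trans (if-false (==-≢ θcT)) (trans (if-false (==-≢ θcT)) (trans (if-false (==-≢ θctB)) (if-true (==-refl (θ c)))))
    ins-o : ∀ z → z ≢ A → z ≢ B → z ≢ tB → z ≢ θ c → insert a b Q z ≡ Q z
    ins-o z p q r s = trans (if-false (==-≢ p)) (trans (if-false (==-≢ q)) (trans (if-false (==-≢ r)) (if-false (==-≢ s))))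

    insI-B : insertInv a b Q Qi B ≡ A
    insI-B = if-true (==-refl B)
    insI-c : insertInv a b Q Qi c ≡ B
    insI-c = trans (if-false (==-≢ cB)) (if-true (==-refl c))
    insI-tA : insertInv a b Q Qi tA ≡ tB
    insI-tA = trans (if-false (==-≢ (λ e → cS (sym e)))) (if-true (==-refl tA))
    insI-tB : insertInv a b Q Qi tB ≡ θ c
    insI-tB = trans (if-false (==-≢ (λ e → cS (sym e)))) (trans (if-false (==-≢ (λ e → tAtB (sym e)))) (if-true (==-refl tB)))
    insI-o : ∀ w → w ≢ B → w ≢ c → w ≢ tA → w ≢ tB → insertInv a b Q Qi w ≡ Qi w
    insI-o w p q r s = trans (if-false (==-≢ p)) (trans (if-false (==-≢ q)) (trans (if-false (==-≢ r)) (if-false (==-≢ s))))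

    data InsCase (z : X n) : Set where
      zA : z ≡ A → InsCase z
      zB : z ≡ B → InsCase z
      ztB : z ≡ tB → InsCase z
      zθc : z ≡ θ c → InsCase z
      zo : z ≢ A → z ≢ B → z ≢ tB → z ≢ θ c → InsCase z

    insCase : ∀ z → InsCase z
    insCase z with X-split z A
    ... | inj₁ p = zA p
    ... | inj₂ p with X-split z B
    ... | inj₁ q = zB q
    ... | inj₂ q with X-split z tB
    ... | inj₁ r = ztB r
    ... | inj₂ r with X-split z (θ c)
    ... | inj₁ s = zθc s
    ... | inj₂ s = zo p q r s

    data InsICase (w : X n) : Set where
      wB : w ≡ B → InsICase w
      wc : w ≡ c → InsICase w
      wtA : w ≡ tA → InsICase w
      wtB : w ≡ tB → InsICase w
      wo : w ≢ B → w ≢ c → w ≢ tA → w ≢ tB → InsICase w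

    insICase : ∀ w → InsICase w
    insICase w with X-split w B
    ... | inj₁ p = wB p
    ... | inj₂ p with X-split w c
    ... | inj₁ q = wc q
    ... | inj₂ q with X-split w tA
    ... | inj₁ r = wtA r
    ... | inj₂ r with X-split w tB
    ... | inj₁ s = wtB s
    ... | inj₂ s = wo p q r s

    Qo-B : ∀ z → z ≢ B → Q z ≢ B
    Qo-B z p e = p (PE-dead-preimage hq B z D'B e)
    Qo-tB : ∀ z → z ≢ tB → Q z ≢ tB
    Qo-tB z p e = p (PE-dead-preimage hq tB z D'tB e)
    Qo-c : ∀ z → z ≢ A → Q z ≢ c
    Qo-c z p e = p (PE-injective hq e)
    Qo-tA : ∀ z → z ≢ θ c → Q z ≢ tA
    Qo-tA z p e = p (PE-injective hq (trans e (sym Qθc)))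

    ins-linv : ∀ z → insertInv a b Q Qi (insert a b Q z) ≡ z
    ins-linv z with insCase z
    ... | zA refl = trans (cong (insertInv a b Q Qi) ins-A) insI-B
    ... | zB refl = trans (cong (insertInv a b Q Qi) ins-B) insI-c
    ... | ztB refl = trans (cong (insertInv a b Q Qi) ins-tB) insI-tA
    ... | zθc refl = trans (cong (insertInv a b Q Qi) ins-θc) insI-tB
    ... | zo p q r s = trans (cong (insertInv a b Q Qi) (ins-o z p q r s)) (trans (insI-o (Q z) (Qo-B z q) (Qo-c z p) (Qo-tA z s) (Qo-tB z r)) (leftInverse hq z))

    ins-rinv : ∀ w → insert a b Q (insertInv a b Q Qi w) ≡ w
    ins-rinv w with insICase w
    ... | wB refl = trans (cong (insert a b Q) insI-B) ins-A
    ... | wc refl = trans (cong (insert a b Q) insI-c) ins-B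
    ... | wtA refl = trans (cong (insert a b Q) insI-tA) ins-tB
    ... | wtB refl = trans (cong (insert a b Q) insI-tB) ins-θc
    ... | wo p q r s = trans (cong (insert a b Q) (insI-o w p q r s)) (trans (ins-o (Qi w) p' q' r' s') (rightInverse hq w))
      where
      p' : Qi w ≢ A
      p' e = q (trans (sym (rightInverse hq w)) (cong Q e))
      q' : Qi w ≢ B
      q' e = p (trans (sym (rightInverse hq w)) (trans (cong Q e) (fixes-dead hq B D'B)))
      r' : Qi w ≢ tB
      r' e = s (trans (sym (rightInverse hq w)) (trans (cong Q e) (fixes-dead hq tB D'tB)))
      s' : Qi w ≢ θ c
      s' e = r (trans (sym (rightInverse hq w)) (trans (cong Q e) Qθc))

    dθc-D : D (θ c) ≡ true
    dθc-D = D'→D (θ c) dθc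

    ins-dead : ∀ z → D z ≡ false → insert a b Q z ≡ z
    ins-dead z dz = trans (ins-o z (nd A (D'→D A dA)) (nd B dB) (nd tB dtB) (nd (θ c) dθc-D)) (fixes-dead hq z d'z)
      where
      nd : ∀ w → D w ≡ true → z ≢ w
      nd w dw refl with trans (sym dz) dw
      ... | ()
      d'z : D' z ≡ false
      d'z with D' z in e
      ... | true with trans (sym (D'→D z e)) dz
      ... | ()
      d'z | false = refl

    ins-live : ∀ z → D z ≡ true → D (insert a b Q z) ≡ true
    ins-live z dz with insCase z
    ... | zA refl = trans (cong D ins-A) dB
    ... | zB refl = trans (cong D ins-B) (D'→D c dc)
    ... | ztB refl = trans (cong D ins-tB) (D'→D tA dtA)
    ... | zθc refl = trans (cong D ins-θc) dtB
    ... | zo p q r s = trans (cong D (ins-o z p q r s)) (D'→D (Q z) (live-closed hq z (D→D' z dz q r)))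

    ins-S : ∀ k → ∃ λ l → insert a b Q (inj₁ k) ≡ inj₁ l
    ins-S k with insCase (inj₁ k)
    ... | zA refl = b , ins-A
    ... | zB refl = proj₁ cl , trans ins-B (proj₂ cl)
    ... | ztB ()
    ... | zθc e = ⊥-elim (θcT (sym e))
    ... | zo p q r s = proj₁ (maps-S hq k) , trans (ins-o (inj₁ k) p q r s) (proj₂ (maps-S hq k))

    ins-T : ∀ k → ∃ λ l → insert a b Q (inj₂ k) ≡ inj₂ l
    ins-T k with insCase (inj₂ k)
    ... | zA ()
    ... | zB ()
    ... | ztB refl = a , ins-tB
    ... | zθc e = b , trans (cong (insert a b Q) e) ins-θc
    ... | zo p q r s = proj₁ (maps-Sθ hq k) , trans (ins-o (inj₂ k) p q r s) (proj₂ (maps-Sθ hq k))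

    ins-rev : ∀ k → insert a b Q (θ (insert a b Q (inj₁ k))) ≡ θ (inj₁ k)
    ins-rev k with insCase (inj₁ k)
    ... | zA refl rewrite ins-A = ins-tB
    ... | zB refl rewrite ins-B = ins-θc
    ... | ztB ()
    ... | zθc e = ⊥-elim (θcT (sym e))
    ... | zo p q r s rewrite ins-o (inj₁ k) p q r s = trans (ins-o (θ (Q K)) p' q' r' s') (reverses hq k)
      where
      K = inj₁ k
      QK = maps-S hq k
      p' : θ (Q K) ≢ A
      p' e = T≢S (trans (sym (cong θ (proj₂ QK))) e)
      q' : θ (Q K) ≢ B
      q' e = T≢S (trans (sym (cong θ (proj₂ QK))) e)
      r' : θ (Q K) ≢ tB
      r' e = Qo-B K q (θ-injective e)
      s' : θ (Q K) ≢ θ c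
      s' e = Qo-c K p (θ-injective e)

    PE-insert : PartialEmbedding D (insert a b Q) (insertInv a b Q Qi)
    PE-insert = record
      { fixes-dead = ins-dead ; live-closed = ins-live ; leftInverse = ins-linv ; rightInverse = ins-rinv
      ; maps-S = ins-S ; maps-Sθ = ins-T ; reverses = ins-rev }

-- One reduction step
module _ {n : ℕ} where

  skip-pred : ∀ (x : X n) g y → y ≢ x → g y ≡ x → skip x g y ≡ g x
  skip-pred x g y p q = trans (skip-other x g y p) (if-true (≡⇒== q))
  skip-nonpred : ∀ (x : X n) g y → y ≢ x → g y ≢ x → skip x g y ≡ g y
  skip-nonpred x g y p q = trans (skip-other x g y p) (if-false (==-≢ q))

  -- P′Q′ on the live points and the identity on the deleted ones, which thus contribute one cycle each.
  composeLive : (X n → Bool) → Perm n → (X n → X n) → X n → X n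
  composeLive D P Q y = if D y then Q (fwd P y) else y

  composeLive-live : ∀ D P Q (y : X n) → D y ≡ true → composeLive D P Q y ≡ Q (fwd P y)
  composeLive-live D P Q y e = if-true e
  composeLive-dead : ∀ D P Q (y : X n) → D y ≡ false → composeLive D P Q y ≡ y
  composeLive-dead D P Q y e = if-false e

  ==-ext : ∀ {x y z w : X n} → (x ≡ y → z ≡ w) → (z ≡ w → x ≡ y) → (x == y) ≡ (z == w)
  ==-ext f g = true⇔true⇒≡ (λ e → ≡⇒== (f (==-≡ e))) (λ e → ≡⇒== (g (==-≡ e)))

  composeLive-injective : ∀ {D P Q Qi} → PermOn D P → PartialEmbedding D Q Qi → Injective _≡_ _≡_ (composeLive D P Q)
  composeLive-injective {D} {P} {Q} hp hq {y1} {y2} e with true-or-false (D y1) | true-or-false (D y2)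
  ... | inj₁ d1 | inj₁ d2 = PermOn-injective hp d1 d2 (PE-injective hq (trans (sym (composeLive-live D P Q y1 d1)) (trans e (composeLive-live D P Q y2 d2))))
  ... | inj₁ d1 | inj₂ d2 with trans (sym (live-closed hq (fwd P y1) (fwd-closed hp y1 d1))) (trans (cong D (trans (sym (composeLive-live D P Q y1 d1)) (trans e (composeLive-dead D P Q y2 d2)))) d2)
  ... | ()
  composeLive-injective {D} {P} {Q} hp hq {y1} {y2} e | inj₂ d1 | inj₁ d2 with trans (sym (live-closed hq (fwd P y2) (fwd-closed hp y2 d2))) (trans (cong D (trans (sym (composeLive-live D P Q y2 d2)) (trans (sym e) (composeLive-dead D P Q y1 d1)))) d1)
  ... | ()
  composeLive-injective {D} {P} {Q} hp hq {y1} {y2} e | inj₂ d1 | inj₂ d2 = trans (sym (composeLive-dead D P Q y1 d1)) (trans e (composeLive-dead D P Q y2 d2))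

  -- Deleting b and then θa from the cycles of P·Qs, and conjugating by the transposition (θa θb),
  -- yields P_{a,θa}·Q on the remaining points; each deletion loses a cycle exactly when the point
  -- was fixed, and the two fixedness tests are the two deltas of the edge weight.
  module ChildStep (D : X n → Bool) (P : Perm n) (h : PermOn D P) (a b : Fin n)
                (D' : X n → Bool) (Q Qi : X n → X n) (hq : PartialEmbedding D' Q Qi)
                (D'≡ : ∀ z → D' z ≡ ((D ∖ inj₁ b) ∖ inj₂ b) z)
                (dB : D (inj₁ b) ≡ true) (dtB : D (inj₂ b) ≡ true)
                (dA : D' (inj₁ a) ≡ true) (θcl : ∀ z → D' (θ z) ≡ D' z) where
    open Insertion D D' Q Qi hq a b D'≡ dB dtB dA θcl
    D1 = D ∖ B
    dA-D : D A ≡ true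
    dA-D = D'→D A dA
    dtA-D : D tA ≡ true
    dtA-D = D'→D tA dtA
    open ReductionA D P h a b dA-D dB AB using (PB; relabelA) renaming (PermOn-redA to hR; redA-char to Rchar)
    R = redA P a b
    dtA1 : D1 tA ≡ true
    dtA1 = ∖-intro D B tA dtA-D T≢S
    dtB1 : D1 tB ≡ true
    dtB1 = ∖-intro D B tB dtB T≢S
    open ReductionAθ R a b D1 hR dtA1 dtB1 tAtB using (u; du; Ru; charθ; PermOn-redAθ′; redAθ′-char; Rne)

    Qs : X n → X n
    Qs = insert a b Q
    PQs : X n → X n
    PQs = composeLive D P Qs
    skipB skipBθA swapθ : X n → X n
    skipB = skip B PQs
    skipBθA = skip tA skipB
    swapθ = swapF tA tB
    Qo : X n → X n
    Qo z = if z == A then c else Qs z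

    insB : ∀ z → Qs z ≡ B → z ≡ A
    insB z e with insCase z
    ... | zA p = p
    ... | zB refl = ⊥-elim (cB (trans (sym ins-B) e))
    ... | ztB refl with trans (sym ins-tB) e
    ... | ()
    insB z e | zθc refl with trans (sym ins-θc) e
    ... | ()
    insB z e | zo p q r s = ⊥-elim (Qo-B z q (trans (sym (ins-o z p q r s)) e))

    D1→D' : ∀ z → D1 z ≡ true → z ≢ tB → D' z ≡ true
    D1→D' z d p = trans (D'≡ z) (∖-intro D1 tB z d p)

    skipB-char : ∀ y → D1 y ≡ true → skipB y ≡ Qo (fwd R y)
    skipB-char y dy = trans cycles-step (sym (trans (cong Qo (Rchar y dy)) fin))
      where
      dy' = ∖-base D B y dy
      yB = ∖-≢ D B y dy
      PQ-y : PQs y ≡ Qs (fwd P y)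
      PQ-y = composeLive-live D P Qs y dy'
      RiB : PQs B ≡ Qs PB
      RiB = composeLive-live D P Qs B dB
      target = if fwd P y == A then Qs PB else Qs (fwd P y)
      cycles-step : skipB y ≡ target
      cycles-step with X-split (fwd P y) A
      ... | inj₁ e = trans (skip-pred B PQs y yB (trans PQ-y (trans (cong Qs e) ins-A))) (trans RiB (sym (if-true (≡⇒== e))))
      ... | inj₂ e = trans (skip-nonpred B PQs y yB (λ q → e (insB (fwd P y) (trans (sym PQ-y) q)))) (trans PQ-y (sym (if-false (==-≢ e))))
      fin : Qo (relabelA (fwd P y)) ≡ target
      fin with X-split PB B
      ... | inj₁ pb with X-split (fwd P y) A
      ...   | inj₁ e = trans (cong Qo (if-true (≡⇒== pb))) (trans (if-true (≡⇒== e)) (sym (trans (if-true (≡⇒== e)) (trans (cong Qs pb) ins-B))))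
      ...   | inj₂ e = trans (cong Qo (if-true (≡⇒== pb))) (trans (if-false (==-≢ e)) (sym (if-false (==-≢ e))))
      fin | inj₂ pb with X-split (fwd P y) B
      ...   | inj₁ e = trans (cong Qo (trans (if-false (==-≢ pb)) (if-true (≡⇒== e)))) (trans (if-true (==-refl A)) (sym (trans (if-false (==-≢ (λ q → AB (trans (sym q) e)))) (trans (cong Qs e) ins-B))))
      ...   | inj₂ e with X-split (fwd P y) A
      ...     | inj₁ f = trans (cong Qo (trans (if-false (==-≢ pb)) (trans (if-false (==-≢ e)) (if-true (≡⇒== f))))) (trans (if-false (==-≢ PBA)) (sym (if-true (≡⇒== f))))
        where
        PBA : PB ≢ A
        PBA q = yB (PermOn-injective h dy' dB (trans f (sym q)))
      ...     | inj₂ f = trans (cong Qo (trans (if-false (==-≢ pb)) (trans (if-false (==-≢ e)) (if-false (==-≢ f))))) (trans (if-false (==-≢ f)) (sym (if-false (==-≢ f))))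

    Qo°-tA : ∀ z → D1 z ≡ true → Qo z ≡ tA → z ≡ tB
    Qo°-tA z dz e with X-split z A
    ... | inj₁ p = ⊥-elim (cS (trans (sym (if-true (≡⇒== p))) e))
    ... | inj₂ p with insCase z
    ...   | zA q = ⊥-elim (p q)
    ...   | zB q = ⊥-elim (∖-≢ D B z dz q)
    ...   | ztB q = q
    ...   | zθc refl = ⊥-elim (tAtB (sym (trans (sym (trans (if-false (==-≢ p)) ins-θc)) e)))
    ...   | zo p' q r s = ⊥-elim (Qo-tA z s (trans (sym (trans (if-false (==-≢ p)) (ins-o z p' q r s))) e))

    Qo°-tB : Qo tB ≡ tA
    Qo°-tB = ins-tB

    swapθ-Qo : ∀ z → D' z ≡ true → swapθ (Qo z) ≡ Q z
    swapθ-Qo z dz with X-split z A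
    ... | inj₁ refl = trans (cong swapθ (if-true (==-refl A))) (swapF-other tA tB c cS cS)
    ... | inj₂ p with insCase z
    ...   | zA q = ⊥-elim (p q)
    ...   | zB q = ⊥-elim (D'→B z dz q)
    ...   | ztB q = ⊥-elim (D'→tB z dz q)
    ...   | zθc refl = trans (cong swapθ (trans (if-false (==-≢ p)) ins-θc)) (trans (swapF-second tA tB (λ e → tAtB (sym e))) (sym Qθc))
    ...   | zo p' q r s = trans (cong swapθ (trans (if-false (==-≢ p)) (ins-o z p' q r s))) (swapF-other tA tB (Q z) (Qo-tA z s) (Qo-tB z r))

    P′ : Perm n
    P′ = redAθ′ R a b

    skipB-b : skipB B ≡ B
    skipB-b = skip-self B PQs

    D'1 : ∀ z → D' z ≡ true → (D1 ∖ tB) z ≡ true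
    D'1 z e = trans (sym (D'≡ z)) e

    live-case-θa : (u ≡ tB) ⊎ (u ≢ tB) → Q (charθ tA) ≡ swapθ (skipBθA (swapθ tA))
    live-case-θa (inj₁ uB) = trans (cong Q (if-true (≡⇒== uB))) (sym (trans (cong (λ v → swapθ (skipBθA v)) (swapF-first tA tB)) (trans (cong swapθ skipBθA-θb) (swapθ-Qo (fwd R tA) dRtA))))
      where
      RtB : fwd R tB ≡ tB
      RtB = trans (cong (fwd R) (sym uB)) Ru
      skipB-θb : skipB tB ≡ tA
      skipB-θb = trans (skipB-char tB dtB1) (trans (cong Qo RtB) Qo°-tB)
      skipBθA-θb : skipBθA tB ≡ Qo (fwd R tA)
      skipBθA-θb = trans (skip-pred tA skipB tB (λ e → tAtB (sym e)) skipB-θb) (skipB-char tA dtA1)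
      dRtA : D' (fwd R tA) ≡ true
      dRtA = D1→D' (fwd R tA) (fwd-closed hR tA dtA1) (Rne tA dtA1 (λ e → tAtB (trans e uB)))
    live-case-θa (inj₂ uB) = trans (cong Q (trans (if-false (==-≢ uB)) (if-true (==-refl tA)))) (sym (trans (cong (λ v → swapθ (skipBθA v)) (swapF-first tA tB)) (trans (cong swapθ skipBθA-θb) (swapθ-Qo (fwd R tB) dRtB))))
      where
      RtBne : fwd R tB ≢ tB
      RtBne = Rne tB dtB1 (λ e → uB (sym e))
      skipBθA-θb : skipBθA tB ≡ Qo (fwd R tB)
      skipBθA-θb = trans (skip-nonpred tA skipB tB (λ e → tAtB (sym e)) (λ e → RtBne (Qo°-tA (fwd R tB) (fwd-closed hR tB dtB1) (trans (sym (skipB-char tB dtB1)) e)))) (skipB-char tB dtB1)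
      dRtB : D' (fwd R tB) ≡ true
      dRtB = D1→D' (fwd R tB) (fwd-closed hR tB dtB1) RtBne

    live-case : ∀ y → D' y ≡ true → Q (fwd P′ y) ≡ swapθ (skipBθA (swapθ y))
    live-case y dy = trans (cong Q (redAθ′-char y dy1)) (split-θa (X-split y tA))
      where
      dy1 = D'1 y dy
      yD1 = ∖-base D1 tB y dy1
      ytB = ∖-≢ D1 tB y dy1
      split-θa : (y ≡ tA) ⊎ (y ≢ tA) → Q (charθ y) ≡ swapθ (skipBθA (swapθ y))
      split-θa (inj₁ refl) = live-case-θa (X-split u tB)
      split-θa (inj₂ ytA) = trans (split-u (X-split u tB)) (sym (cong (λ v → swapθ (skipBθA v)) (swapF-other tA tB y ytA ytB)))
        where
        skipB-y : skipB y ≡ Qo (fwd R y)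
        skipB-y = skipB-char y yD1
        generic-y : fwd R y ≢ tB → swapθ (skipBθA y) ≡ Q (fwd R y)
        generic-y ne = trans (cong swapθ (trans (skip-nonpred tA skipB y ytA (λ e → ne (Qo°-tA (fwd R y) (fwd-closed hR y yD1) (trans (sym skipB-y) e)))) skipB-y)) (swapθ-Qo (fwd R y) (D1→D' (fwd R y) (fwd-closed hR y yD1) ne))
        split-u-y : (uB : u ≢ tB) → (y ≡ u) ⊎ (y ≢ u) → Q (charθ y) ≡ swapθ (skipBθA y)
        split-u-y uB (inj₁ yu) = trans (cong Q (trans (if-false (==-≢ uB)) (trans (if-false (==-≢ ytA)) (if-true (≡⇒== yu))))) (sym (trans (cong swapθ skipBθA-y) (swapθ-Qo (fwd R tA) dRtA)))
          where
          Ry : fwd R y ≡ tB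
          Ry = trans (cong (fwd R) yu) Ru
          skipBθA-y : skipBθA y ≡ Qo (fwd R tA)
          skipBθA-y = trans (skip-pred tA skipB y ytA (trans skipB-y (trans (cong Qo Ry) Qo°-tB))) (skipB-char tA dtA1)
          dRtA : D' (fwd R tA) ≡ true
          dRtA = D1→D' (fwd R tA) (fwd-closed hR tA dtA1) (Rne tA dtA1 (λ e → ytA (trans yu (sym e))))
        split-u-y uB (inj₂ yu) = trans (cong Q (trans (if-false (==-≢ uB)) (trans (if-false (==-≢ ytA)) (if-false (==-≢ yu))))) (sym (generic-y (Rne y yD1 yu)))
        split-u : (u ≡ tB) ⊎ (u ≢ tB) → Q (charθ y) ≡ swapθ (skipBθA y)
        split-u (inj₁ uB) = trans (cong Q (if-true (≡⇒== uB))) (sym (generic-y (Rne y yD1 (λ e → ytB (trans e uB)))))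
        split-u (inj₂ uB) = split-u-y uB (X-split y u)

    dead-case : ∀ y → D' y ≡ false → swapθ (skipBθA (swapθ y)) ≡ y
    dead-case y dy = split-b y dy (X-split y B)
      where
      split-θb : ∀ y → D' y ≡ false → y ≢ B → (y ≡ tB) ⊎ (y ≢ tB) → swapθ (skipBθA (swapθ y)) ≡ y
      split-θb y dy yB (inj₁ refl) = trans (cong (λ v → swapθ (skipBθA v)) (swapF-second tA tB (λ e → tAtB (sym e)))) (trans (cong swapθ (skip-self tA skipB)) (swapF-first tA tB))
      split-θb y dy yB (inj₂ ytB) = trans (cong swapθ (cong skipBθA swapθ-y)) (trans (cong swapθ skipBθA-y) swapθ-y)
        where
        D-split : (D y ≡ true) ⊎ (D y ≡ false) → D y ≡ false
        D-split (inj₁ e) with () ← trans (sym (D→D' y e yB ytB)) dy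
        D-split (inj₂ e) = e
        Dy : D y ≡ false
        Dy = D-split (true-or-false (D y))
        ytA : y ≢ tA
        ytA e with () ← trans (sym Dy) (trans (cong D e) dtA-D)
        swapθ-y : swapθ y ≡ y
        swapθ-y = swapF-other tA tB y ytA ytB
        PQ-y : PQs y ≡ y
        PQ-y = composeLive-dead D P Qs y Dy
        skipB-y : skipB y ≡ y
        skipB-y = trans (skip-nonpred B PQs y yB (λ e → yB (trans (sym PQ-y) e))) PQ-y
        skipBθA-y : skipBθA y ≡ y
        skipBθA-y = trans (skip-nonpred tA skipB y ytA (λ e → ytA (trans (sym skipB-y) e))) skipB-y
      split-b : ∀ y → D' y ≡ false → (y ≡ B) ⊎ (y ≢ B) → swapθ (skipBθA (swapθ y)) ≡ y
      split-b y dy (inj₁ refl) = trans (cong swapθ (cong skipBθA (swapF-other tA tB B S≢T S≢T))) (trans (cong swapθ (trans (skip-nonpred tA skipB B S≢T (λ e → S≢T (trans (sym skipB-b) e))) skipB-b)) (swapF-other tA tB B S≢T S≢T))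
      split-b y dy (inj₂ yB) = split-θb y dy yB (X-split y tB)

    reduced≡conjugate : ∀ y → composeLive D' P′ Q y ≡ swapθ (skipBθA (swapθ y))
    reduced≡conjugate y = split-live (true-or-false (D' y))
      where
      split-live : (D' y ≡ true) ⊎ (D' y ≡ false) → composeLive D' P′ Q y ≡ swapθ (skipBθA (swapθ y))
      split-live (inj₁ dy) = trans (composeLive-live D' P′ Q y dy) (live-case y dy)
      split-live (inj₂ dy) = trans (composeLive-dead D' P′ Q y dy) (sym (dead-case y dy))

    fixed-b : (PQs B == B) ≡ (A == PB)
    fixed-b = trans (cong (_== B) (composeLive-live D P Qs B dB)) (==-ext (λ e → sym (insB PB e)) (λ e → trans (cong Qs (sym e)) ins-A))

    fixed-θa : (skipB tA == tA) ≡ (fwd R tA == tB)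
    fixed-θa = trans (cong (_== tA) (skipB-char tA dtA1)) (==-ext (λ e → Qo°-tA (fwd R tA) (fwd-closed hR tA dtA1) e) (λ e → trans (cong Qo e) Qo°-tB))

    PQs-injective : Injective _≡_ _≡_ PQs
    PQs-injective = composeLive-injective h PE-insert

    cycles-step : cycles PQs + 2 ≡ cycles (composeLive D' P′ Q) + (indicator (A == PB) + indicator (fwd R tA == tB))
    cycles-step = begin
      cycles PQs + 2                  ≡⟨ cycles-skip₂ PQs PQs-injective B tA ⟩
      cycles skipBθA + (δ₁ + δ₂)      ≡⟨ cong₂ _+_ conjugate (cong₂ _+_ (cong indicator fixed-b) (cong indicator fixed-θa)) ⟩
      cycles (composeLive D' P′ Q) + (indicator (A == PB) + indicator (fwd R tA == tB)) ∎
      where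
      open ≡-Reasoning
      δ₁ = indicator (PQs B == B)
      δ₂ = indicator (skipB tA == tA)
      conjugate : cycles skipBθA ≡ cycles (composeLive D' P′ Q)
      conjugate = sym (trans (cycles-cong _ _ reduced≡conjugate)
        (Conjugation.cycles-conjugate swapθ (swapF-involutive tA tB) skipBθA (skip-injective tA skipB (skip-injective B PQs PQs-injective))))

    PermOn-next : PermOn D' P′
    PermOn-next = PermOn-resp (λ z → sym (D'≡ z)) PermOn-redAθ′

  module SingletonStep (D : X n → Bool) (P : Perm n) (h : PermOn D P) (b : Fin n)
                 (D' : X n → Bool) (Q Qi : X n → X n) (hq : PartialEmbedding D' Q Qi)
                 (D'≡ : ∀ z → D' z ≡ ((D ∖ inj₁ b) ∖ inj₂ b) z)
                 (dB : D (inj₁ b) ≡ true) (dtB : D (inj₂ b) ≡ true) where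
    B tB : X n
    B = inj₁ b
    tB = inj₂ b
    D1 = D ∖ B
    P1 P′ : Perm n
    P1 = del B P
    P′ = del tB P1
    h1 : PermOn D1 P1
    h1 = PermOn-del B h dB
    dtB1 : D1 tB ≡ true
    dtB1 = ∖-intro D B tB dtB T≢S
    D'B : D' B ≡ false
    D'B = trans (D'≡ B) (cong (λ v → (v ∧ not (B == tB))) (trans (cong (D B ∧_) (cong not (==-refl B))) (∧-zero (D B))))
      where
      ∧-zero : ∀ x → (x ∧ false) ≡ false
      ∧-zero true = refl
      ∧-zero false = refl
    D'tB : D' tB ≡ false
    D'tB = trans (D'≡ tB) (trans (cong (((D ∖ B) tB) ∧_) (cong not (==-refl tB))) (∧-zero ((D ∖ B) tB)))
      where
      ∧-zero : ∀ x → (x ∧ false) ≡ false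
      ∧-zero true = refl
      ∧-zero false = refl
    D'→D : ∀ z → D' z ≡ true → D z ≡ true
    D'→D z e = ∖-base D B z (∖-base D1 tB z (trans (sym (D'≡ z)) e))

    QOn-D : PartialEmbedding D Q Qi
    QOn-D = record
      { fixes-dead = λ z dz → fixes-dead hq z (dd z dz)
      ; live-closed = ql
      ; leftInverse = leftInverse hq ; rightInverse = rightInverse hq ; maps-S = maps-S hq ; maps-Sθ = maps-Sθ hq ; reverses = reverses hq }
      where
      dd : ∀ z → D z ≡ false → D' z ≡ false
      dd z dz with true-or-false (D' z)
      ... | inj₁ e with trans (sym (D'→D z e)) dz
      ... | ()
      dd z dz | inj₂ e = e
      ql : ∀ z → D z ≡ true → D (Q z) ≡ true
      ql z dz with true-or-false (D' z)
      ... | inj₁ e = D'→D (Q z) (live-closed hq z e)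
      ... | inj₂ e = trans (cong D (fixes-dead hq z e)) dz

    PQ skipB skipBθB : X n → X n
    PQ = composeLive D P Q
    skipB = skip B PQ
    skipBθB = skip tB skipB
    PQ-injective : Injective _≡_ _≡_ PQ
    PQ-injective = composeLive-injective h QOn-D

    skipB-char : ∀ y → D1 y ≡ true → skipB y ≡ Q (fwd P1 y)
    skipB-char y dy with X-split (fwd P y) B
    ... | inj₁ e = trans (skip-pred B PQ y yB (trans (composeLive-live D P Q y dy') (trans (cong Q e) (fixes-dead hq B D'B)))) (trans (composeLive-live D P Q B dB) (cong Q (sym (if-true (≡⇒== e)))))
      where dy' = ∖-base D B y dy
            yB = ∖-≢ D B y dy
    ... | inj₂ e = trans (skip-nonpred B PQ y yB (λ q → e (PE-dead-preimage hq B (fwd P y) D'B (trans (sym (composeLive-live D P Q y dy')) q)))) (trans (composeLive-live D P Q y dy') (cong Q (sym (if-false (==-≢ e)))))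
      where dy' = ∖-base D B y dy
            yB = ∖-≢ D B y dy

    reduced≡skip : ∀ y → composeLive D' P′ Q y ≡ skipBθB y
    reduced≡skip y with true-or-false (D' y)
    ... | inj₁ dy = trans (composeLive-live D' P′ Q y dy) (split-θb (X-split (fwd P1 y) tB))
      where
      dy1 = trans (sym (D'≡ y)) dy
      yD1 = ∖-base D1 tB y dy1
      ytB = ∖-≢ D1 tB y dy1
      split-θb : (fwd P1 y ≡ tB) ⊎ (fwd P1 y ≢ tB) → Q (fwd P′ y) ≡ skipBθB y
      split-θb (inj₁ e) = trans (cong Q (if-true (≡⇒== e))) (sym (trans (skip-pred tB skipB y ytB (trans (skipB-char y yD1) (trans (cong Q e) (fixes-dead hq tB D'tB)))) (skipB-char tB dtB1)))
      split-θb (inj₂ e) = trans (cong Q (if-false (==-≢ e))) (sym (trans (skip-nonpred tB skipB y ytB (λ q → e (PE-dead-preimage hq tB (fwd P1 y) D'tB (trans (sym (skipB-char y yD1)) q)))) (skipB-char y yD1)))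
    ... | inj₂ dy = trans (composeLive-dead D' P′ Q y dy) (sym (split-b (X-split y B)))
      where
      split-b : (y ≡ B) ⊎ (y ≢ B) → skipBθB y ≡ y
      split-b (inj₁ refl) = trans (skip-nonpred tB skipB B S≢T (λ e → S≢T (trans (sym (skip-self B PQ)) e))) (skip-self B PQ)
      split-b (inj₂ yB) with X-split y tB
      ... | inj₁ refl = skip-self tB skipB
      ... | inj₂ ytB = skipBθB-y
        where
        Dy : D y ≡ false
        Dy with D y in e
        ... | true with () ← trans (sym (trans (D'≡ y) (∖-intro D1 tB y (∖-intro D B y e yB) ytB))) dy
        ... | false = refl
        PQ-y : PQ y ≡ y
        PQ-y = composeLive-dead D P Q y Dy
        skipB-y : skipB y ≡ y
        skipB-y = trans (skip-nonpred B PQ y yB (λ e → yB (trans (sym PQ-y) e))) PQ-y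
        skipBθB-y : skipBθB y ≡ y
        skipBθB-y = trans (skip-nonpred tB skipB y ytB (λ e → ytB (trans (sym skipB-y) e))) skipB-y

    fixed-b : (PQ B == B) ≡ (B == fwd P B)
    fixed-b = trans (cong (_== B) (composeLive-live D P Q B dB)) (trans (PE-==-dead hq B (fwd P B) D'B) (==-sym (fwd P B) B))

    fixed-θb : (skipB tB == tB) ≡ (tB == fwd P1 tB)
    fixed-θb = trans (cong (_== tB) (skipB-char tB dtB1)) (trans (PE-==-dead hq tB (fwd P1 tB) D'tB) (==-sym (fwd P1 tB) tB))

    cycles-step : cycles PQ + 2 ≡ cycles (composeLive D' P′ Q) + (indicator (B == fwd P B) + indicator (tB == fwd P1 tB))
    cycles-step = begin
      cycles PQ + 2              ≡⟨ cycles-skip₂ PQ PQ-injective B tB ⟩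
      cycles skipBθB + (δ₁ + δ₂) ≡⟨ cong₂ _+_ (sym (cycles-cong _ _ reduced≡skip)) (cong₂ _+_ (cong indicator fixed-b) (cong indicator fixed-θb)) ⟩
      cycles (composeLive D' P′ Q) + (indicator (B == fwd P B) + indicator (tB == fwd P1 tB)) ∎
      where
      open ≡-Reasoning
      δ₁ = indicator (PQ B == B)
      δ₂ = indicator (skipB tB == tB)

    PermOn-next : PermOn D' P′
    PermOn-next = PermOn-resp (λ z → sym (D'≡ z)) (PermOn-del tB h1 dtB1)

-- Decoding a path; the weight identity
module _ {n : ℕ} where

  data Distinct : List (Fin n) → Set where
    [] : Distinct []
    _∷_ : ∀ {b bs} → (b ∈ᵇ bs) ≡ false → Distinct bs → Distinct (b ∷ bs)

  live-θ : ∀ bs (z : X n) → live bs (θ z) ≡ live bs z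
  live-θ bs (inj₁ _) = refl
  live-θ bs (inj₂ _) = refl

  live-b : ∀ b bs → live (b ∷ bs) (inj₁ b) ≡ true
  live-b b bs rewrite ==F-refl {n} b = refl
  live-θb : ∀ b bs → live (b ∷ bs) (inj₂ b) ≡ true
  live-θb b bs rewrite ==F-refl {n} b = refl

  live-split : ∀ b bs → (b ∈ᵇ bs) ≡ false → ∀ z → live bs z ≡ ((live (b ∷ bs) ∖ inj₁ b) ∖ inj₂ b) z
  live-split b bs nb z with X-split z (inj₁ b)
  ... | inj₁ refl = trans nb (sym (trans (cong (λ v → ((v ∧ not (inj₁ b == inj₁ b)) ∧ not (inj₁ b == inj₂ b))) (live-b b bs)) (cong (λ v → (v ∧ true)) (cong (λ v → (true ∧ not v)) (==-refl (inj₁ b))))))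
  ... | inj₂ zB with X-split z (inj₂ b)
  ...   | inj₁ refl = trans nb (sym (trans (cong (λ v → (v ∧ not (inj₂ b == inj₂ b))) (∖-intro (live (b ∷ bs)) (inj₁ b) (inj₂ b) (live-θb b bs) (λ ()))) (cong (λ v → (true ∧ not v)) (==-refl (inj₂ b)))))
  ...   | inj₂ ztB = sym (trans (cong (λ v → ((live (b ∷ bs) z ∧ not v) ∧ not (z == inj₂ b))) (==-≢ zB)) (trans (cong (λ v → ((live (b ∷ bs) z ∧ true) ∧ not v)) (==-≢ ztB)) (trans (∧-identityʳ _) (trans (∧-identityʳ _) (lem z zB ztB)))))
    where
    lem : ∀ z → z ≢ inj₁ b → z ≢ inj₂ b → live (b ∷ bs) z ≡ live bs z
    lem (inj₁ k) p q rewrite ==F-≢ {x = k} {y = b} (λ e → p (cong inj₁ e)) = refl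
    lem (inj₂ k) p q rewrite ==F-≢ {x = k} {y = b} (λ e → q (cong inj₂ e)) = refl

  PE-widen : ∀ (D D' : X n → Bool) Q Qi → PartialEmbedding D' Q Qi → ∀ b → (∀ z → D' z ≡ ((D ∖ inj₁ b) ∖ inj₂ b) z) →
              D (inj₁ b) ≡ true → D (inj₂ b) ≡ true → (∀ z → D' z ≡ true → D z ≡ true) → PartialEmbedding D Q Qi
  PE-widen D D' Q Qi hq b D'≡ dB dtB D'→D = record
      { fixes-dead = λ z dz → fixes-dead hq z (dd z dz)
      ; live-closed = ql
      ; leftInverse = leftInverse hq ; rightInverse = rightInverse hq ; maps-S = maps-S hq ; maps-Sθ = maps-Sθ hq ; reverses = reverses hq }
      where
      dd : ∀ z → D z ≡ false → D' z ≡ false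
      dd z dz with true-or-false (D' z)
      ... | inj₁ e with trans (sym (D'→D z e)) dz
      ... | ()
      dd z dz | inj₂ e = e
      ql : ∀ z → D z ≡ true → D (Q z) ≡ true
      ql z dz with true-or-false (D' z)
      ... | inj₁ e = D'→D (Q z) (live-closed hq z e)
      ... | inj₂ e = trans (cong D (fixes-dead hq z e)) dz

  live-∷ : ∀ b bs (z : X n) → live bs z ≡ true → live (b ∷ bs) z ≡ true
  live-∷ b bs z e with label z ==F b
  ... | true = refl
  ... | false = e

  isChild⇒live : ∀ (blk : Fin n → Fin n) a b bs → T (isChild blk a b bs) → (a ∈ᵇ bs) ≡ true
  isChild⇒live blk a b bs t with a ==F b
  isChild⇒live blk a b bs () | true
  ... | false with a ∈ᵇ bs
  ... | true = refl
  isChild⇒live blk a b bs () | false | false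

  decode : ∀ {blk P bs} → Path {n} blk P bs → X n → X n
  decode done = λ z → z
  decode (single _ p) = decode p
  decode (child {b = b} a _ p) = insert a b (decode p)

  decodeI : ∀ {blk P bs} → Path {n} blk P bs → X n → X n
  decodeI done = λ z → z
  decodeI (single _ p) = decodeI p
  decodeI (child {b = b} a _ p) = insertInv a b (decode p) (decodeI p)

  PE-decode : ∀ {blk P bs} (p : Path {n} blk P bs) → Distinct bs → PartialEmbedding (live bs) (decode p) (decodeI p)
  PE-decode done [] = record
    { fixes-dead = λ z _ → refl ; live-closed = λ z () ; leftInverse = λ z → refl ; rightInverse = λ z → refl
    ; maps-S = λ k → k , refl ; maps-Sθ = λ k → k , refl ; reverses = λ k → refl }
  PE-decode {bs = b ∷ bs} (single _ p) (nb ∷ u) =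
    PE-widen (live (b ∷ bs)) (live bs) _ _ (PE-decode p u) b (live-split b bs nb) (live-b b bs) (live-θb b bs) (live-∷ b bs)
  PE-decode {blk = blk} {bs = b ∷ bs} (child a t p) (nb ∷ u) =
    Insertion.PE-insert (live (b ∷ bs)) (live bs) (decode p) (decodeI p) (PE-decode p u) a b (live-split b bs nb) (live-b b bs) (live-θb b bs) (isChild⇒live blk a b bs t) (live-θ bs)

  liveSize : List (Fin n) → ℕ
  liveSize [] = 0
  liveSize (_ ∷ bs) = 2 + liveSize bs

  private
    add-step : ∀ c c′ w k W N → c + 2 ≡ c′ + w → c′ + k ≡ W + N → c + (2 + k) ≡ (w + W) + N
    add-step c c′ w k W N step ih = begin
      c + (2 + k)     ≡⟨ +-assoc c 2 k ⟨
      (c + 2) + k     ≡⟨ cong (_+ k) step ⟩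
      (c′ + w) + k    ≡⟨ +-assoc c′ w k ⟩
      c′ + (w + k)    ≡⟨ cong (c′ +_) (+-comm w k) ⟩
      c′ + (k + w)    ≡⟨ +-assoc c′ k w ⟨
      (c′ + k) + w    ≡⟨ cong (_+ w) ih ⟩
      (W + N) + w     ≡⟨ +-comm (W + N) w ⟩
      w + (W + N)     ≡⟨ +-assoc w W N ⟨
      (w + W) + N     ∎
      where open ≡-Reasoning

  cycles-decode≡weight : ∀ {blk P bs} (p : Path {n} blk P bs) → Distinct bs → PermOn (live bs) P →
     cycles (composeLive (live bs) P (decode p)) + liveSize bs ≡ weight p + (n + n)
  cycles-decode≡weight done [] hp = trans (+-identityʳ _) (cycles-id {n})
  cycles-decode≡weight {P = P} {bs = b ∷ bs} (single t p) (nb ∷ u) hp =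
    add-step _ _ _ _ _ _ S.cycles-step (cycles-decode≡weight p u S.PermOn-next)
    where
    module S = SingletonStep (live (b ∷ bs)) P hp b (live bs) (decode p) (decodeI p) (PE-decode p u)
                 (live-split b bs nb) (live-b b bs) (live-θb b bs)
  cycles-decode≡weight {blk = blk} {P = P} {bs = b ∷ bs} (child a t p) (nb ∷ u) hp =
    add-step _ _ _ _ _ _ C.cycles-step (cycles-decode≡weight p u C.PermOn-next)
    where
    module C = ChildStep (live (b ∷ bs)) P hp a b (live bs) (decode p) (decodeI p) (PE-decode p u)
                 (live-split b bs nb) (live-b b bs) (live-θb b bs) (isChild⇒live blk a b bs t) (live-θ bs)

-- Deleting b and θb from an embedding
module _ {n : ℕ} where

  skip-closed : ∀ (D : X n → Bool) (x : X n) g → (∀ z → D z ≡ true → D (g z) ≡ true) → (∀ {y z} → D y ≡ true → D z ≡ true → g y ≡ g z → y ≡ z) →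
             D x ≡ true → ∀ z → (D ∖ x) z ≡ true → (D ∖ x) (skip x g z) ≡ true
  skip-closed D x g gl gi dx z dz with X-split (g z) x
  ... | inj₁ e = subst (λ v → (D ∖ x) v ≡ true) (sym (skip-pred x g z zx e)) (∖-intro D x (g x) (gl x dx) (λ q → zx (gi dz' dx (trans e (sym q)))))
    where dz' = ∖-base D x z dz
          zx = ∖-≢ D x z dz
  ... | inj₂ e = subst (λ v → (D ∖ x) v ≡ true) (sym (skip-nonpred x g z zx e)) (∖-intro D x (g z) (gl z dz') e)
    where dz' = ∖-base D x z dz
          zx = ∖-≢ D x z dz

  skip-inverse : ∀ (x : X n) g gi → (∀ z → gi (g z) ≡ z) → (∀ z → g (gi z) ≡ z) → ∀ z → skip x gi (skip x g z) ≡ z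
  skip-inverse x g gi li ri z with X-split z x
  ... | inj₁ refl = trans (cong (skip z gi) (skip-self z g)) (skip-self z gi)
  ... | inj₂ zx with X-split (g z) x
  ...   | inj₁ e = trans (cong (skip x gi) (skip-pred x g z zx e)) (trans (skip-pred x gi (g x) gxx (li x)) (trans (cong gi (sym e)) (li z)))
    where gxx : g x ≢ x
          gxx q = zx (trans (sym (li z)) (trans (cong gi (trans e (sym q))) (li x)))
  ...   | inj₂ e = trans (cong (skip x gi) (skip-nonpred x g z zx e)) (trans (skip-nonpred x gi (g z) e (λ q → zx (trans (sym (li z)) q))) (li z))

  Fin-split : (x y : Fin n) → (x ≡ y) ⊎ (x ≢ y)
  Fin-split x y with x ≟F y
  ... | yes p = inj₁ p
  ... | no p = inj₂ p

  removePair : Fin n → (X n → X n) → X n → X n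
  removePair b Q = skip (inj₂ b) (skip (inj₁ b) Q)

  record LiveEmbedding (blk : Fin n → Fin n) (bs : List (Fin n)) (Q Qi : X n → X n) : Set where
    field
      partial : PartialEmbedding (live bs) Q Qi
      block-closed : ∀ k → live bs (inj₁ k) ≡ true → ∃ λ l → Q (inj₁ k) ≡ inj₁ l × blk l ≡ blk k
      one-cycle : ∀ k l → live bs (inj₁ k) ≡ true → live bs (inj₁ l) ≡ true → blk k ≡ blk l → ∃ λ m → iter Q m (inj₁ k) ≡ inj₁ l
  open LiveEmbedding public

  module Removal (blk : Fin n → Fin n) (b : Fin n) (bs : List (Fin n)) (nb : (b ∈ᵇ bs) ≡ false)
             (Q Qi : X n → X n) (e : LiveEmbedding blk (b ∷ bs) Q Qi) where
    B tB : X n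
    B = inj₁ b
    tB = inj₂ b
    D = live (b ∷ bs)
    hq = partial e
    Q1 Q2 Qi1 Qi2 : X n → X n
    Q1 = skip B Q
    Q2 = skip tB Q1
    Qi1 = skip B Qi
    Qi2 = skip tB Qi1
    injQ : Injective _≡_ _≡_ Q
    injQ = PE-injective hq
    injQ1 : Injective _≡_ _≡_ Q1
    injQ1 = skip-injective B Q injQ
    Q1B : Q1 B ≡ B
    Q1B = skip-self B Q
    Q2B : Q2 B ≡ B
    Q2B = trans (skip-nonpred tB Q1 B S≢T (λ q → S≢T (trans (sym Q1B) q))) Q1B
    Q2tB : Q2 tB ≡ tB
    Q2tB = skip-self tB Q1
    QS : ∀ k → ∃ λ l → Q (inj₁ k) ≡ inj₁ l
    QS = maps-S hq
    QT : ∀ k → ∃ λ l → Q (inj₂ k) ≡ inj₂ l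
    QT = maps-Sθ hq
    QKB : ∀ k → Q (inj₂ k) ≢ B
    QKB k q = T≢S (trans (sym (proj₂ (QT k))) q)
    Q1S : ∀ k → k ≢ b → ∃ λ l → Q1 (inj₁ k) ≡ inj₁ l
    Q1S k kb with X-split (Q (inj₁ k)) B
    ... | inj₁ q = proj₁ (QS b) , trans (skip-pred B Q (inj₁ k) (λ r → kb (cong label r)) q) (proj₂ (QS b))
    ... | inj₂ q = proj₁ (QS k) , trans (skip-nonpred B Q (inj₁ k) (λ r → kb (cong label r)) q) (proj₂ (QS k))
    Q2S-eq : ∀ k → k ≢ b → Q2 (inj₁ k) ≡ Q1 (inj₁ k)
    Q2S-eq k kb = skip-nonpred tB Q1 (inj₁ k) S≢T (λ q → S≢T (trans (sym (proj₂ (Q1S k kb))) q))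

    D1 = D ∖ B
    Q1live : ∀ z → D1 z ≡ true → D1 (Q1 z) ≡ true
    Q1live = skip-closed D B Q (live-closed hq) (λ _ _ q → injQ q) (live-b b bs)
    Q2live' : ∀ z → (D1 ∖ tB) z ≡ true → (D1 ∖ tB) (Q2 z) ≡ true
    Q2live' = skip-closed D1 tB Q1 Q1live (λ _ _ q → injQ1 q) (∖-intro D B tB (live-θb b bs) T≢S)
    split = live-split b bs nb

    Q2-fixes-dead : ∀ z → live bs z ≡ false → Q2 z ≡ z
    Q2-fixes-dead z dz with X-split z B
    ... | inj₁ refl = Q2B
    ... | inj₂ zB with X-split z tB
    ...   | inj₁ refl = Q2tB
    ...   | inj₂ ztB = trans (skip-nonpred tB Q1 z ztB (λ q → ztB (trans (sym Q1z) q))) Q1z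
      where
      Dz : D z ≡ false
      Dz with true-or-false (D z)
      ... | inj₁ q with trans (sym (trans (split z) (∖-intro D1 tB z (∖-intro D B z q zB) ztB))) dz
      ... | ()
      Dz | inj₂ q = q
      Qz : Q z ≡ z
      Qz = fixes-dead hq z Dz
      Q1z : Q1 z ≡ z
      Q1z = trans (skip-nonpred B Q z zB (λ q → zB (trans (sym Qz) q))) Qz
    Q2-maps-S : ∀ k → ∃ λ l → Q2 (inj₁ k) ≡ inj₁ l
    Q2-maps-S k with Fin-split k b
    ... | inj₁ refl = b , Q2B
    ... | inj₂ kb = proj₁ (Q1S k kb) , trans (Q2S-eq k kb) (proj₂ (Q1S k kb))
    Q1-Sθ : ∀ k → Q1 (inj₂ k) ≡ Q (inj₂ k)
    Q1-Sθ k = skip-nonpred B Q (inj₂ k) T≢S (QKB k)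
    Q2-maps-Sθ : ∀ k → ∃ λ l → Q2 (inj₂ k) ≡ inj₂ l
    Q2-maps-Sθ k with Fin-split k b
    ... | inj₁ refl = b , Q2tB
    ... | inj₂ kb with X-split (Q1 (inj₂ k)) tB
    ...   | inj₁ q = proj₁ (QT b) , trans (skip-pred tB Q1 (inj₂ k) (λ r → kb (cong label r)) q) (trans (Q1-Sθ b) (proj₂ (QT b)))
    ...   | inj₂ q = proj₁ (QT k) , trans (skip-nonpred tB Q1 (inj₂ k) (λ r → kb (cong label r)) q) (trans (Q1-Sθ k) (proj₂ (QT k)))
    Q2-reverses : ∀ k → Q2 (θ (Q2 (inj₁ k))) ≡ θ (inj₁ k)
    Q2-reverses k with Fin-split k b
    ... | inj₁ refl = trans (cong (λ v → Q2 (θ v)) Q2B) Q2tB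
    ... | inj₂ kb with X-split (Q (inj₁ k)) B
    ...   | inj₁ q = trans (cong (λ v → Q2 (θ v)) (trans (Q2S-eq k kb) Q1K)) step
      where
      K = inj₁ k
      kB : K ≢ B
      kB r = kb (cong label r)
      Q1K : Q1 K ≡ Q B
      Q1K = skip-pred B Q K kB q
      QBB : Q B ≢ B
      QBB r = kB (injQ (trans q (sym r)))
      v = θ (Q B)
      vtB : v ≢ tB
      vtB r = QBB (θ-injective r)
      vB : v ≢ B
      vB r = T≢S (trans (sym (cong θ (proj₂ (QS b)))) r)
      Qv : Q v ≡ tB
      Qv = reverses hq b
      Q1v : Q1 v ≡ tB
      Q1v = trans (skip-nonpred B Q v vB (λ r → T≢S (trans (sym Qv) r))) Qv
      QtB : Q tB ≡ θ K
      QtB = trans (cong (λ w → Q (θ w)) (sym q)) (reverses hq k)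
      step : Q2 v ≡ θ K
      step = trans (skip-pred tB Q1 v vtB Q1v) (trans (Q1-Sθ b) QtB)
    ...   | inj₂ q = trans (cong (λ v → Q2 (θ v)) (trans (Q2S-eq k kb) Q1K)) step
      where
      K = inj₁ k
      kB : K ≢ B
      kB r = kb (cong label r)
      Q1K : Q1 K ≡ Q K
      Q1K = skip-nonpred B Q K kB q
      v = θ (Q K)
      vtB : v ≢ tB
      vtB r = q (θ-injective r)
      vB : v ≢ B
      vB r = T≢S (trans (sym (cong θ (proj₂ (QS k)))) r)
      Qv : Q v ≡ θ K
      Qv = reverses hq k
      Q1v : Q1 v ≡ θ K
      Q1v = trans (skip-nonpred B Q v vB (λ r → T≢S (trans (sym Qv) r))) Qv
      step : Q2 v ≡ θ K
      step = trans (skip-nonpred tB Q1 v vtB (λ r → kb (cong label (trans (sym Q1v) r)))) Q1v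

    Q2-partial : PartialEmbedding (live bs) Q2 Qi2
    Q2-partial = record
      { fixes-dead = Q2-fixes-dead ; live-closed = λ z d → trans (split (Q2 z)) (Q2live' z (trans (sym (split z)) d))
      ; leftInverse = λ z → skip-inverse tB Q1 Qi1 (skip-inverse B Q Qi (leftInverse hq) (rightInverse hq)) (skip-inverse B Qi Q (rightInverse hq) (leftInverse hq)) z
      ; rightInverse = λ z → skip-inverse tB Qi1 Q1 (skip-inverse B Qi Q (rightInverse hq) (leftInverse hq)) (skip-inverse B Q Qi (leftInverse hq) (rightInverse hq)) z
      ; maps-S = Q2-maps-S ; maps-Sθ = Q2-maps-Sθ ; reverses = Q2-reverses }

    kb-of : ∀ k → live bs (inj₁ k) ≡ true → k ≢ b
    kb-of k d refl with trans (sym d) nb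
    ... | ()

    live-up : ∀ k → live bs (inj₁ k) ≡ true → live (b ∷ bs) (inj₁ k) ≡ true
    live-up k d = live-∷ b bs (inj₁ k) d

    Q2-block-closed : ∀ k → live bs (inj₁ k) ≡ true → ∃ λ l → Q2 (inj₁ k) ≡ inj₁ l × blk l ≡ blk k
    Q2-block-closed k d with block-closed e k (live-up k d)
    ... | l , q , bl with X-split (Q (inj₁ k)) B
    ...   | inj₁ r with block-closed e b (live-b b bs)
    ...     | l' , q' , bl' = l' , trans (Q2S-eq k kb) (trans (skip-pred B Q (inj₁ k) (λ s → kb (cong label s)) r) q') , trans bl' (trans (cong blk (sym lb)) bl)
      where kb = kb-of k d
            lb : l ≡ b
            lb = cong label (trans (sym q) r)
    Q2-block-closed k d | l , q , bl | inj₂ r = l , trans (Q2S-eq k kb) (trans (skip-nonpred B Q (inj₁ k) (λ s → kb (cong label s)) r) q) , bl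
      where kb = kb-of k d

    Q2-one-cycle : ∀ k l → live bs (inj₁ k) ≡ true → live bs (inj₁ l) ≡ true → blk k ≡ blk l → ∃ λ m → iter Q2 m (inj₁ k) ≡ inj₁ l
    Q2-one-cycle k l dk dl bl with one-cycle e k l (live-up k dk) (live-up l dl) bl
    ... | m , q with iter⇒iter-skip B Q injQ (inj₁ k) (λ s → kb-of k dk (cong label s)) m
    ...   | inj₂ (zx , _) = ⊥-elim (kb-of l dl (cong label (trans (sym q) zx)))
    ...   | inj₁ (_ , m1 , q1) with iter⇒iter-skip tB Q1 injQ1 (inj₁ k) S≢T m1
    ...     | inj₂ (zx , _) = ⊥-elim (S≢T (trans (sym (trans q1 q)) zx))
    ...     | inj₁ (_ , m2 , q2) = m2 , trans q2 (trans q1 q)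

    removePair-embedding : LiveEmbedding blk bs Q2 Qi2
    removePair-embedding = record { partial = Q2-partial ; block-closed = Q2-block-closed ; one-cycle = Q2-one-cycle }

-- Decoded paths are embeddings
module _ {n : ℕ} where

  ∈ᵇ→∈ : ∀ (c : Fin n) bs → (c ∈ᵇ bs) ≡ true → c ∈ bs
  ∈ᵇ→∈ c bs e with any-true⁻ (c ==F_) bs e
  ... | z , m , q = subst (_∈ bs) (sym (==F-≡ q)) m

  ∈→∈ᵇ : ∀ (c : Fin n) bs → c ∈ bs → (c ∈ᵇ bs) ≡ true
  ∈→∈ᵇ c bs m = any-true⁺ (c ==F_) bs m (==F-refl c)

  isSingleton⇒unique : ∀ (blk : Fin n → Fin n) b bs → T (isSingleton blk b bs) → ∀ c → (c ∈ᵇ bs) ≡ true → blk c ≡ blk b → c ≡ b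
  isSingleton⇒unique blk b bs t c m bl with c ≟F b
  ... | yes p = p
  ... | no p with any-false⁻ (λ c → not (c ==F b) ∧ (blk c ==F blk b)) (b ∷ bs) (T-not⇒false t) (there (∈ᵇ→∈ c bs m))
  ... | e rewrite ==F-≢ p | bl | ==F-refl (blk b) with e
  ... | ()

  ¬isSingleton⇒partner : ∀ (blk : Fin n → Fin n) b bs → isSingleton blk b bs ≡ false → ∃ λ c → (c ∈ᵇ bs) ≡ true × c ≢ b × blk c ≡ blk b
  ¬isSingleton⇒partner blk b bs s with any-true⁻ (λ c → not (c ==F b) ∧ (blk c ==F blk b)) (b ∷ bs) (not-injective s)
  ... | c , m , q = c , mem m , cb , ==F-≡ (∧-true⇒ʳ {not (c ==F b)} q)
    where
    cb : c ≢ b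
    cb e with trans (sym (∧-true⇒ˡ {not (c ==F b)} q)) (cong not (trans (cong (_==F b) e) (==F-refl b)))
    ... | ()
    mem : c ∈ (b ∷ bs) → (c ∈ᵇ bs) ≡ true
    mem (here e) = ⊥-elim (cb e)
    mem (there m') = ∈→∈ᵇ c bs m'

  isChild⇒sameBlock : ∀ (blk : Fin n → Fin n) a b bs → T (isChild blk a b bs) → blk a ≡ blk b
  isChild⇒sameBlock blk a b bs t = ==F-≡ (∧-true⇒ʳ {a ∈ᵇ (b ∷ bs)} (∧-true⇒ʳ {not (a ==F b)} (T⇒≡true t)))

  isChild⇒≢ : ∀ (blk : Fin n → Fin n) a b bs → T (isChild blk a b bs) → a ≢ b
  isChild⇒≢ blk a b bs t e with trans (sym (∧-true⇒ˡ {not (a ==F b)} (T⇒≡true t))) (cong not (trans (cong (_==F b) e) (==F-refl b)))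
  ... | ()

  isChild-intro : ∀ (blk : Fin n → Fin n) a b bs → a ≢ b → (a ∈ᵇ (b ∷ bs)) ≡ true → blk a ≡ blk b → T (isChild blk a b bs)
  isChild-intro blk a b bs ne m bl = ≡true⇒T (trans (cong (λ v → not v ∧ ((a ∈ᵇ (b ∷ bs)) ∧ (blk a ==F blk b))) (==F-≢ ne)) (trans (cong (λ v → v ∧ (blk a ==F blk b)) m) (trans (cong (blk a ==F_) (sym bl)) (==F-refl (blk a)))))

  live-∷⁻ : ∀ b bs (k : Fin n) → live (b ∷ bs) (inj₁ k) ≡ true → k ≢ b → live bs (inj₁ k) ≡ true
  live-∷⁻ b bs k e kb with k ==F b | ==F-≢ {x = k} {y = b} kb
  ... | false | _ = e

  iter-simulate : ∀ (F G : X n → X n) (Inv : X n → Set) → (∀ z → Inv z → Inv (G z)) → (∀ z → Inv z → ∃ λ k → iter F k z ≡ G z) →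
        ∀ m x → Inv x → (Inv (iter G m x)) × (∃ λ k → iter F k x ≡ iter G m x)
  iter-simulate F G Inv Inv-step reaches-next zero x ix = ix , 0 , refl
  iter-simulate F G Inv Inv-step reaches-next (suc m) x ix with iter-simulate F G Inv Inv-step reaches-next m x ix
  ... | iw , k , e with reaches-next (iter G m x) iw
  ...   | k' , e' = Inv-step _ iw , k' + k , trans (iter-+ F k' k x) (trans (cong (iter F k') e) e')

  module SingletonExtension (blk : Fin n → Fin n) (b : Fin n) (bs : List (Fin n)) (nb : (b ∈ᵇ bs) ≡ false)
                (Q Qi : X n → X n) (ih : LiveEmbedding blk bs Q Qi) (t : T (isSingleton blk b bs)) where
    QB : Q (inj₁ b) ≡ inj₁ b
    QB = fixes-dead (partial ih) (inj₁ b) nb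
    extended-block-closed : ∀ k → live (b ∷ bs) (inj₁ k) ≡ true → ∃ λ l → Q (inj₁ k) ≡ inj₁ l × blk l ≡ blk k
    extended-block-closed k dk with Fin-split k b
    ... | inj₁ refl = k , QB , refl
    ... | inj₂ kb = block-closed ih k (live-∷⁻ b bs k dk kb)
    extended-one-cycle : ∀ k l → live (b ∷ bs) (inj₁ k) ≡ true → live (b ∷ bs) (inj₁ l) ≡ true → blk k ≡ blk l → ∃ λ m → iter Q m (inj₁ k) ≡ inj₁ l
    extended-one-cycle k l dk dl bl with Fin-split k b | Fin-split l b
    ... | inj₁ refl | inj₁ refl = 0 , refl
    ... | inj₁ refl | inj₂ lb = ⊥-elim (lb (isSingleton⇒unique blk b bs t l (live-∷⁻ b bs l dl lb) (sym bl)))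
    ... | inj₂ kb | inj₁ refl = ⊥-elim (kb (isSingleton⇒unique blk b bs t k (live-∷⁻ b bs k dk kb) bl))
    ... | inj₂ kb | inj₂ lb = one-cycle ih k l (live-∷⁻ b bs k dk kb) (live-∷⁻ b bs l dl lb) bl
    extended : LiveEmbedding blk (b ∷ bs) Q Qi
    extended = record { partial = PE-widen (live (b ∷ bs)) (live bs) Q Qi (partial ih) b (live-split b bs nb) (live-b b bs) (live-θb b bs) (live-∷ b bs) ; block-closed = extended-block-closed ; one-cycle = extended-one-cycle }

  module InsertionExtension (blk : Fin n → Fin n) (b : Fin n) (bs : List (Fin n)) (nb : (b ∈ᵇ bs) ≡ false)
                (Q' Qi' : X n → X n) (ih : LiveEmbedding blk bs Q' Qi') (a : Fin n) (t : T (isChild blk a b bs)) where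
    dA : live bs (inj₁ a) ≡ true
    dA = isChild⇒live blk a b bs t
    open Insertion (live (b ∷ bs)) (live bs) Q' Qi' (partial ih) a b (live-split b bs nb) (live-b b bs) (live-θb b bs) dA (live-θ bs)
    Qs = insert a b Q'
    abl : blk a ≡ blk b
    abl = isChild⇒sameBlock blk a b bs t
    extended-block-closed : ∀ k → live (b ∷ bs) (inj₁ k) ≡ true → ∃ λ l → Qs (inj₁ k) ≡ inj₁ l × blk l ≡ blk k
    extended-block-closed k dk with insCase (inj₁ k)
    ... | zA refl = b , ins-A , sym abl
    ... | zB refl with block-closed ih a dA
    ...   | l , q , bl = l , trans ins-B q , trans bl abl
    extended-block-closed k dk | ztB ()
    extended-block-closed k dk | zθc e = ⊥-elim (θcT (sym e))
    extended-block-closed k dk | zo p' q r s with block-closed ih k (live-∷⁻ b bs k dk (λ e → q (cong inj₁ e)))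
    ... | l , q' , bl = l , trans (ins-o (inj₁ k) p' q r s) q' , bl
    Inv : X n → Set
    Inv z = ∃ λ l → z ≡ inj₁ l × live bs z ≡ true
    Inv-step : ∀ z → Inv z → Inv (Q' z)
    Inv-step z (l , refl , d) = proj₁ (maps-S (partial ih) l) , proj₂ (maps-S (partial ih) l) , live-closed (partial ih) z d
    reaches-next : ∀ z → Inv z → ∃ λ k → iter Qs k z ≡ Q' z
    reaches-next z (l , refl , d) with Fin-split l a
    ... | inj₁ refl = 2 , trans (cong Qs ins-A) ins-B
    ... | inj₂ la = 1 , ins-o (inj₁ l) (λ e → la (cong label e)) (D'→B (inj₁ l) d) S≢T (λ e → θcT (sym e))
    orbit-lift : ∀ k l m → live bs (inj₁ k) ≡ true → iter Q' m (inj₁ k) ≡ inj₁ l → ∃ λ j → iter Qs j (inj₁ k) ≡ inj₁ l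
    orbit-lift k l m d e with iter-simulate Qs Q' Inv Inv-step reaches-next m (inj₁ k) (k , refl , d)
    ... | _ , j , q = j , trans q e
    extended-one-cycle : ∀ k l → live (b ∷ bs) (inj₁ k) ≡ true → live (b ∷ bs) (inj₁ l) ≡ true → blk k ≡ blk l → ∃ λ m → iter Qs m (inj₁ k) ≡ inj₁ l
    extended-one-cycle k l dk dl bl with Fin-split k b | Fin-split l b
    ... | inj₁ refl | inj₁ refl = 0 , refl
    ... | inj₁ refl | inj₂ lb with block-closed ih a dA
    ...   | l0 , q0 , bl0 with one-cycle ih l0 l (subst (λ v → live bs v ≡ true) q0 (live-closed (partial ih) (inj₁ a) dA)) (live-∷⁻ b bs l dl lb) (trans bl0 (trans abl bl))
    ...     | m , qm with orbit-lift l0 l m (subst (λ v → live bs v ≡ true) q0 (live-closed (partial ih) (inj₁ a) dA)) qm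
    ...       | j , qj = j + 1 , trans (iter-+ Qs j 1 (inj₁ k)) (trans (cong (iter Qs j) (trans ins-B q0)) qj)
    extended-one-cycle k l dk dl bl | inj₂ kb | inj₁ refl with one-cycle ih k a (live-∷⁻ b bs k dk kb) dA (trans bl (sym abl))
    ... | m , qm with orbit-lift k a m (live-∷⁻ b bs k dk kb) qm
    ...   | j , qj = suc j , trans (cong Qs qj) ins-A
    extended-one-cycle k l dk dl bl | inj₂ kb | inj₂ lb with one-cycle ih k l (live-∷⁻ b bs k dk kb) (live-∷⁻ b bs l dl lb) bl
    ... | m , qm = orbit-lift k l m (live-∷⁻ b bs k dk kb) qm

    extended : LiveEmbedding blk (b ∷ bs) Qs (insertInv a b Q' Qi')
    extended = record { partial = PE-insert ; block-closed = extended-block-closed ; one-cycle = extended-one-cycle }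

  decode-embedding : ∀ {blk P bs} (p : Path {n} blk P bs) → Distinct bs → LiveEmbedding blk bs (decode p) (decodeI p)
  decode-embedding pp@done [] = record { partial = PE-decode pp [] ; block-closed = λ k () ; one-cycle = λ k l () }
  decode-embedding {blk = blk} {bs = b ∷ bs} pp@(single t p) (nb ∷ u) = SingletonExtension.extended blk b bs nb (decode p) (decodeI p) (decode-embedding p u) t
  decode-embedding {blk = blk} {bs = b ∷ bs} pp@(child a t p) (nb ∷ u) = InsertionExtension.extended blk b bs nb (decode p) (decodeI p) (decode-embedding p u) a t

-- Encoding an embedding as a path
module _ {n : ℕ} where

  skip-cong : ∀ (x : X n) g g' → (∀ z → g z ≡ g' z) → ∀ z → skip x g z ≡ skip x g' z
  skip-cong x g g' h z = cong₂ (λ u v → if z == x then x else (if v == x then u else v)) (h x) (h z)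

  removePair-cong : ∀ b (g g' : X n → X n) → (∀ z → g z ≡ g' z) → ∀ z → removePair b g z ≡ removePair b g' z
  removePair-cong b g g' h = skip-cong (inj₂ b) _ _ (skip-cong (inj₁ b) g g' h)

  insert-cong : ∀ a b (g g' : X n → X n) → (∀ z → g z ≡ g' z) → ∀ z → insert a b g z ≡ insert a b g' z
  insert-cong a b g g' h z = cong₂ (λ u v → if z == inj₁ a then inj₁ b else (if z == inj₁ b then u else (if z == inj₂ b then inj₂ a else (if z == θ u then inj₂ b else v)))) (h (inj₁ a)) (h z)

  removePair-fixed : ∀ b (Q : X n → X n) → Injective _≡_ _≡_ Q → Q (inj₁ b) ≡ inj₁ b → Q (inj₂ b) ≡ inj₂ b → ∀ z → removePair b Q z ≡ Q z
  removePair-fixed b Q inj QB QtB z with X-split z (inj₁ b)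
  ... | inj₁ refl = trans (skip-nonpred (inj₂ b) (skip (inj₁ b) Q) z S≢T (λ e → S≢T (trans (sym (skip-self z Q)) e))) (trans (skip-self z Q) (sym QB))
  ... | inj₂ zB with X-split z (inj₂ b)
  ...   | inj₁ refl = trans (skip-self z (skip (inj₁ b) Q)) (sym QtB)
  ...   | inj₂ ztB = trans (skip-nonpred (inj₂ b) (skip (inj₁ b) Q) z ztB (λ e → ztB (inj (trans (sym Q1z) (trans e (sym QtB)))))) Q1z
    where
    Q1z : skip (inj₁ b) Q z ≡ Q z
    Q1z = skip-nonpred (inj₁ b) Q z zB (λ e → zB (inj (trans e (sym QB))))

  module ChildOfEmbedding (blk : Fin n → Fin n) (b : Fin n) (bs : List (Fin n)) (nb : (b ∈ᵇ bs) ≡ false)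
                  (Q Qi : X n → X n) (e : LiveEmbedding blk (b ∷ bs) Q Qi) (s : isSingleton blk b bs ≡ false) where
    B tB : X n
    B = inj₁ b
    tB = inj₂ b
    hq = partial e
    a : Fin n
    a = label (Q tB)
    QtB : Q tB ≡ inj₂ a
    QtB with maps-Sθ hq b
    ... | l , q rewrite q = refl
    A : X n
    A = inj₁ a
    QA : Q A ≡ B
    QA with maps-S hq a
    ... | d , q = trans q (cong inj₁ (cong label (PE-injective hq (trans (trans (cong (λ v → Q (θ v)) (sym q)) (reverses hq a)) (sym QtB)))))
    QBne : Q B ≢ B
    QBne q with ¬isSingleton⇒partner blk b bs s
    ... | c , cm , cb , cbl with one-cycle e b c (live-b b bs) (live-∷ b bs (inj₁ c) cm) (sym cbl)
    ...   | m , qm = cb (cong label (trans (sym qm) (iter-fixed B Q q m)))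
    ab : a ≢ b
    ab q = QBne (trans (cong (λ v → Q (inj₁ v)) (sym q)) QA)
    amem : (a ∈ᵇ (b ∷ bs)) ≡ true
    amem = trans (cong (live (b ∷ bs)) (sym QtB)) (live-closed hq tB (live-θb b bs))
    abl : blk a ≡ blk b
    abl with block-closed e a amem
    ... | l , q , bl = trans (sym bl) (cong blk (cong label (trans (sym q) QA)))
    predecessor-isChild : T (isChild blk a b bs)
    predecessor-isChild = isChild-intro blk a b bs ab amem abl
    dA : live bs A ≡ true
    dA = live-∷⁻ b bs a amem ab

    Q2 Qi2 : X n → X n
    Q2 = removePair b Q
    Qi2 = removePair b Qi
    removePair-embedding = Removal.removePair-embedding blk b bs nb Q Qi e
    open Insertion (live (b ∷ bs)) (live bs) Q2 Qi2 (partial removePair-embedding) a b (live-split b bs nb) (live-b b bs) (live-θb b bs) dA (live-θ bs)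
      using (InsCase; insCase; zA; zB; ztB; zθc; zo; ins-A; ins-B; ins-tB; ins-θc; ins-o)
    Q1A : skip B Q A ≡ Q B
    Q1A = skip-pred B Q A (λ q → ab (cong label q)) QA
    Q2A : Q2 A ≡ Q B
    Q2A = trans (skip-nonpred tB (skip B Q) A S≢T (λ q → S≢T (trans (sym (proj₂ (maps-S hq b))) (trans (sym Q1A) q)))) Q1A

    insert-removePair : ∀ z → insert a b Q2 z ≡ Q z
    insert-removePair z = go z (insCase z)
      where
      go : ∀ z → InsCase z → insert a b Q2 z ≡ Q z
      go z (zA refl) = trans ins-A (sym QA)
      go z (zB refl) = trans ins-B Q2A
      go z (ztB refl) = trans ins-tB (sym QtB)
      go z (zθc refl) = trans ins-θc (sym (trans (cong (λ v → Q (θ v)) Q2A) (reverses hq b)))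
      go z (zo p q r s') = trans (ins-o z p q r s') Q2z
        where
        Q1z : skip B Q z ≡ Q z
        Q1z = skip-nonpred B Q z q (λ e' → p (PE-injective hq (trans e' (sym QA))))
        Q2z : Q2 z ≡ Q z
        Q2z = trans (skip-nonpred tB (skip B Q) z r (λ e' → s' (trans (PE-injective hq (trans (sym Q1z) (trans e' (sym (reverses hq b))))) (cong θ (sym Q2A))))) Q1z

  module RemoveInserted (blk : Fin n → Fin n) (b : Fin n) (bs : List (Fin n)) (nb : (b ∈ᵇ bs) ≡ false)
                (Q' Qi' : X n → X n) (ih : LiveEmbedding blk bs Q' Qi') (a : Fin n) (dA : live bs (inj₁ a) ≡ true) where
    open Insertion (live (b ∷ bs)) (live bs) Q' Qi' (partial ih) a b (live-split b bs nb) (live-b b bs) (live-θb b bs) dA (live-θ bs)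
    hq = partial ih
    Qs = insert a b Q'
    Qs1 = skip B Qs
    Qs1B : Qs1 B ≡ B
    Qs1B = skip-self B Qs
    removePair-insert : ∀ z → removePair b Qs z ≡ Q' z
    removePair-insert z with X-split z B
    ... | inj₁ refl = trans (skip-nonpred tB Qs1 z S≢T (λ q → S≢T (trans (sym Qs1B) q))) (trans Qs1B (sym (fixes-dead hq B D'B)))
    ... | inj₂ nzB with X-split z tB
    ...   | inj₁ refl = trans (skip-self tB Qs1) (sym (fixes-dead hq tB D'tB))
    ...   | inj₂ nztB with X-split z A
    ...     | inj₁ refl = trans (skip-nonpred tB Qs1 z nztB (λ q → cS (trans (sym Qs1A) q))) Qs1A
      where
      Qs1A : Qs1 A ≡ c
      Qs1A = trans (skip-pred B Qs A AB ins-A) ins-B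
    ...     | inj₂ nzA with X-split z (θ c)
    ...       | inj₁ refl = trans (skip-pred tB Qs1 z nztB (trans Qs1z ins-θc)) (trans Qs1tB (sym Qθc))
      where
      Qs1z : Qs1 z ≡ Qs z
      Qs1z = skip-nonpred B Qs z nzB (λ q → nzA (insB' z q))
        where
        insB' : ∀ w → Qs w ≡ B → w ≡ A
        insB' w q = go w (insCase w) q
          where
          go : ∀ w → InsCase w → Qs w ≡ B → w ≡ A
          go w (zA p) q = p
          go w (zB refl) q = ⊥-elim (cB (trans (sym ins-B) q))
          go w (ztB refl) q = ⊥-elim (T≢S (trans (sym ins-tB) q))
          go w (zθc refl) q = ⊥-elim (T≢S (trans (sym ins-θc) q))
          go w (zo p q' r s) q = ⊥-elim (Qo-B w q' (trans (sym (ins-o w p q' r s)) q))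
      Qs1tB : Qs1 tB ≡ tA
      Qs1tB = trans (skip-nonpred B Qs tB T≢S (λ q → T≢S (trans (sym ins-tB) q))) ins-tB
    ...       | inj₂ zθ = trans (skip-nonpred tB Qs1 z nztB (λ q → Qo-tB z nztB (trans (sym Qz) (trans (sym Qs1z) q)))) (trans Qs1z Qz)
      where
      Qz : Qs z ≡ Q' z
      Qz = ins-o z nzA nzB nztB zθ
      Qs1z : Qs1 z ≡ Qs z
      Qs1z = skip-nonpred B Qs z nzB (λ q → Qo-B z nzB (trans (sym Qz) q))

module _ {n : ℕ} where

  mutual
    encode : ∀ (blk : Fin n → Fin n) bs (P : Perm n) (Q Qi : X n → X n) → Distinct bs → LiveEmbedding blk bs Q Qi → Path blk P bs
    encode blk [] P Q Qi [] e = done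
    encode blk (b ∷ bs) P Q Qi (nb ∷ u) e = encodeAt blk b bs P Q Qi nb u e (isSingleton blk b bs) refl

    -- The label of a child edge is the Q-predecessor a of b, read off from Q θb = θa.
    encodeAt : ∀ (blk : Fin n → Fin n) b bs (P : Perm n) (Q Qi : X n → X n) → (b ∈ᵇ bs) ≡ false → Distinct bs → LiveEmbedding blk (b ∷ bs) Q Qi →
              (β : Bool) → isSingleton blk b bs ≡ β → Path blk P (b ∷ bs)
    encodeAt blk b bs P Q Qi nb u e true s = single (subst T (sym s) tt) (encode blk bs (redBθ P b) (removePair b Q) (removePair b Qi) u (Removal.removePair-embedding blk b bs nb Q Qi e))
    encodeAt blk b bs P Q Qi nb u e false s = child (label (Q (inj₂ b))) (ChildOfEmbedding.predecessor-isChild blk b bs nb Q Qi e s) (encode blk bs (redAθ P (label (Q (inj₂ b))) b) (removePair b Q) (removePair b Qi) u (Removal.removePair-embedding blk b bs nb Q Qi e))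

  child-cong : ∀ (blk : Fin n → Fin n) P b bs (E E' : (x : Fin n) → Path blk (redAθ P x b) bs) → (∀ x → E x ≡ E' x) →
               ∀ x y → x ≡ y → (t : T (isChild blk x b bs)) (t' : T (isChild blk y b bs)) → child {P = P} x t (E x) ≡ child {P = P} y t' (E' y)
  child-cong blk P b bs E E' h x .x refl t t' = cong₂ (child {P = P} x) (T-irrelevant t t') (h x)

  isSingleton⇒fixed : ∀ (blk : Fin n → Fin n) b bs (Q Qi : X n → X n) → LiveEmbedding blk (b ∷ bs) Q Qi → T (isSingleton blk b bs) → Q (inj₁ b) ≡ inj₁ b
  isSingleton⇒fixed blk b bs Q Qi e t with block-closed e b (live-b b bs)
  ... | l , q , bl with Fin-split l b
  ...   | inj₁ refl = q
  ...   | inj₂ lb = ⊥-elim (lb (isSingleton⇒unique blk b bs t l (live-∷⁻ b bs l (trans (cong (live (b ∷ bs)) (sym q)) (live-closed (partial e) (inj₁ b) (live-b b bs))) lb) bl))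

  mutual
    decode-encode : ∀ (blk : Fin n → Fin n) bs (P : Perm n) (Q Qi : X n → X n) (u : Distinct bs) (e : LiveEmbedding blk bs Q Qi) → ∀ z → decode (encode blk bs P Q Qi u e) z ≡ Q z
    decode-encode blk [] P Q Qi [] e z = sym (fixes-dead (partial e) z refl)
    decode-encode blk (b ∷ bs) P Q Qi (nb ∷ u) e z = decode-encodeAt blk b bs P Q Qi nb u e (isSingleton blk b bs) refl z

    decode-encodeAt : ∀ (blk : Fin n → Fin n) b bs (P : Perm n) (Q Qi : X n → X n) (nb : (b ∈ᵇ bs) ≡ false) (u : Distinct bs) (e : LiveEmbedding blk (b ∷ bs) Q Qi) →
              (β : Bool) (s : isSingleton blk b bs ≡ β) → ∀ z → decode (encodeAt blk b bs P Q Qi nb u e β s) z ≡ Q z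
    decode-encodeAt blk b bs P Q Qi nb u e true s z = trans (decode-encode blk bs (redBθ P b) (removePair b Q) (removePair b Qi) u (Removal.removePair-embedding blk b bs nb Q Qi e) z) (removePair-fixed b Q (PE-injective (partial e)) QB QtB z)
      where
      t = subst T (sym s) tt
      QB = isSingleton⇒fixed blk b bs Q Qi e t
      QtB : Q (inj₂ b) ≡ inj₂ b
      QtB = trans (cong (λ v → Q (θ v)) (sym QB)) (reverses (partial e) b)
    decode-encodeAt blk b bs P Q Qi nb u e false s z = trans (insert-cong a b _ _ (decode-encode blk bs (redAθ P a b) (removePair b Q) (removePair b Qi) u (Removal.removePair-embedding blk b bs nb Q Qi e)) z) (ChildOfEmbedding.insert-removePair blk b bs nb Q Qi e s z)
      where a = label (Q (inj₂ b))

  mutual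
    encode-cong : ∀ (blk : Fin n → Fin n) bs (P : Perm n) (Q Qi Q' Qi' : X n → X n) (u : Distinct bs) (e : LiveEmbedding blk bs Q Qi) (e' : LiveEmbedding blk bs Q' Qi') →
               (∀ z → Q z ≡ Q' z) → encode blk bs P Q Qi u e ≡ encode blk bs P Q' Qi' u e'
    encode-cong blk [] P Q Qi Q' Qi' [] e e' h = refl
    encode-cong blk (b ∷ bs) P Q Qi Q' Qi' (nb ∷ u) e e' h = encodeAt-cong blk b bs P Q Qi Q' Qi' nb u e e' h (isSingleton blk b bs) refl

    encodeAt-cong : ∀ (blk : Fin n → Fin n) b bs (P : Perm n) (Q Qi Q' Qi' : X n → X n) (nb : (b ∈ᵇ bs) ≡ false) (u : Distinct bs) (e : LiveEmbedding blk (b ∷ bs) Q Qi) (e' : LiveEmbedding blk (b ∷ bs) Q' Qi') →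
               (∀ z → Q z ≡ Q' z) → (β : Bool) (s : isSingleton blk b bs ≡ β) → encodeAt blk b bs P Q Qi nb u e β s ≡ encodeAt blk b bs P Q' Qi' nb u e' β s
    encodeAt-cong blk b bs P Q Qi Q' Qi' nb u e e' h true s = cong (single {P = P} (subst T (sym s) tt)) (encode-cong blk bs (redBθ P b) (removePair b Q) (removePair b Qi) (removePair b Q') (removePair b Qi') u (Removal.removePair-embedding blk b bs nb Q Qi e) (Removal.removePair-embedding blk b bs nb Q' Qi' e') (removePair-cong b Q Q' h))
    encodeAt-cong blk b bs P Q Qi Q' Qi' nb u e e' h false s =
      child-cong blk P b bs (λ x → encode blk bs (redAθ P x b) (removePair b Q) (removePair b Qi) u (Removal.removePair-embedding blk b bs nb Q Qi e))
                 (λ x → encode blk bs (redAθ P x b) (removePair b Q') (removePair b Qi') u (Removal.removePair-embedding blk b bs nb Q' Qi' e'))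
                 (λ x → encode-cong blk bs (redAθ P x b) (removePair b Q) (removePair b Qi) (removePair b Q') (removePair b Qi') u (Removal.removePair-embedding blk b bs nb Q Qi e) (Removal.removePair-embedding blk b bs nb Q' Qi' e') (removePair-cong b Q Q' h))
                 (label (Q (inj₂ b))) (label (Q' (inj₂ b))) (cong label (h (inj₂ b))) (ChildOfEmbedding.predecessor-isChild blk b bs nb Q Qi e s) (ChildOfEmbedding.predecessor-isChild blk b bs nb Q' Qi' e' s)

  encode-decode : ∀ {blk P bs} (p : Path {n} blk P bs) (u : Distinct bs) → encode blk bs P (decode p) (decodeI p) u (decode-embedding p u) ≡ p
  encode-decode done [] = refl
  encode-decode {blk} {P} {b ∷ bs} pp@(single t p) (nb ∷ u) = go (isSingleton blk b bs) refl
    where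
    Q = decode p
    Qi = decodeI p
    e = decode-embedding pp (nb ∷ u)
    ih = decode-embedding p u
    QB : Q (inj₁ b) ≡ inj₁ b
    QB = fixes-dead (partial ih) (inj₁ b) nb
    QtB : Q (inj₂ b) ≡ inj₂ b
    QtB = fixes-dead (partial ih) (inj₂ b) nb
    go : (β : Bool) (s : isSingleton blk b bs ≡ β) → encodeAt blk b bs P Q Qi nb u e β s ≡ single t p
    go true s = cong₂ (single {P = P}) (T-irrelevant _ t)
                  (trans (encode-cong blk bs (redBθ P b) (removePair b Q) (removePair b Qi) Q Qi u (Removal.removePair-embedding blk b bs nb Q Qi e) ih (removePair-fixed b Q (PE-injective (partial ih)) QB QtB))
                         (encode-decode p u))
    go false s = ⊥-elim (subst T s t)
  encode-decode {blk} {P} {b ∷ bs} pp@(child a t p) (nb ∷ u) = go (isSingleton blk b bs) refl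
    where
    Q' = decode p
    Qi' = decodeI p
    ih = decode-embedding p u
    Qs = insert a b Q'
    Qsi = insertInv a b Q' Qi'
    e = decode-embedding pp (nb ∷ u)
    dA : live bs (inj₁ a) ≡ true
    dA = isChild⇒live blk a b bs t
    QstB : Qs (inj₂ b) ≡ inj₂ a
    QstB = if-true (==-refl (inj₂ b))
    go : (β : Bool) (s : isSingleton blk b bs ≡ β) → encodeAt blk b bs P Qs Qsi nb u e β s ≡ child a t p
    go true s = ⊥-elim (isChild⇒≢ blk a b bs t (isSingleton⇒unique blk b bs (subst T (sym s) tt) a dA (isChild⇒sameBlock blk a b bs t)))
    go false s = trans (child-cong blk P b bs
                   (λ x → encode blk bs (redAθ P x b) (removePair b Qs) (removePair b Qsi) u (Removal.removePair-embedding blk b bs nb Qs Qsi e))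
                   (λ x → encode blk bs (redAθ P x b) Q' Qi' u ih)
                   (λ x → encode-cong blk bs (redAθ P x b) (removePair b Qs) (removePair b Qsi) Q' Qi' u (Removal.removePair-embedding blk b bs nb Qs Qsi e) ih (RemoveInserted.removePair-insert blk b bs nb Q' Qi' ih a dA))
                   (label (Qs (inj₂ b))) a (cong label QstB) (ChildOfEmbedding.predecessor-isChild blk b bs nb Qs Qsi e s) t)
                 (cong (child {P = P} a t) (encode-decode p u))

-- The correspondence
module _ {n : ℕ} where

  ordered-live : ∀ (σ : Permutation′ n) (z : X n) → live (ordered σ) z ≡ true
  ordered-live σ z = any-true⁺ (label z ==F_) (ordered σ) m (==F-refl (label z))
    where
    m : label z ∈ ordered σ
    m = subst (_∈ ordered σ) (inverseʳ σ) (∈-tabulate⁺ {f = σ ⟨$⟩ʳ_} (σ ⟨$⟩ˡ label z))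

  tabulate-distinct : ∀ m (f : Fin m → Fin n) → (∀ {i j} → f i ≡ f j → i ≡ j) → Distinct (tabulate f)
  tabulate-distinct zero f inj = []
  tabulate-distinct (suc m) f inj = head-fresh ∷ tabulate-distinct m (λ i → f (suc i)) (λ e → suc-injective (inj e))
    where
    head-fresh : (f zero ∈ᵇ tabulate (λ i → f (suc i))) ≡ false
    head-fresh = any-false⁺ (f zero ==F_) (tabulate (λ i → f (suc i))) λ z mz →
      let (i , q) = ∈-tabulate⁻ {f = λ i → f (suc i)} mz in ==F-≢ {x = f zero} {y = z} (λ e → 0≢1+n (inj (trans e q)))

  ordered-distinct : ∀ (σ : Permutation′ n) → Distinct (ordered σ)
  ordered-distinct σ = tabulate-distinct n (σ ⟨$⟩ʳ_) (λ {i} {j} e → trans (sym (inverseˡ σ)) (trans (cong (σ ⟨$⟩ˡ_) e) (inverseˡ σ)))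

  liveSize-ordered : ∀ (σ : Permutation′ n) → liveSize (ordered σ) ≡ n + n
  liveSize-ordered σ = go (σ ⟨$⟩ʳ_)
    where
    go : ∀ {m} (f : Fin m → Fin n) → liveSize (tabulate f) ≡ m + m
    go {zero} f = refl
    go {suc m} f = trans (cong (2 +_) (go (λ i → f (suc i)))) (cong suc (sym (+-suc m m)))

  permutation-on-ordered : ∀ (σ : Permutation′ n) {P} → IsPermutation P → PermOn (live (ordered σ)) P
  permutation-on-ordered σ {P} (fb , bf) = record
    { fwd-closed = λ y _ → ordered-live σ (fwd P y) ; bwd-closed = λ y _ → ordered-live σ (bwd P y)
    ; fwd-bwd = λ y _ → fb y ; bwd-fwd = λ y _ → bf y }

  module Correspondence (P : Perm n) (blk : Fin n → Fin n) (σ : Permutation′ n) where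
    L = ordered σ
    L-distinct = ordered-distinct σ

    iter-S : ∀ (Q : Perm n) → IsEmbedding blk Q → ∀ m l → ∃ λ l' → iter (fwd Q) m (inj₁ l) ≡ inj₁ l'
    iter-S Q ie zero l = l , refl
    iter-S Q ie (suc m) l with iter-S Q ie m l
    ... | l' , q = proj₁ (IsEmbedding.intoBlock ie l') , trans (cong (fwd Q) q) (proj₁ (proj₂ (IsEmbedding.intoBlock ie l')))

    embedding⇒live : ∀ (Q : Perm n) → IsEmbedding blk Q → LiveEmbedding blk L (fwd Q) (bwd Q)
    embedding⇒live Q ie = record
      { partial = record
        { fixes-dead = nothing-dead
        ; live-closed = λ z _ → ordered-live σ (fwd Q z)
        ; leftInverse = proj₂ (IsEmbedding.isPerm ie)
        ; rightInverse = proj₁ (IsEmbedding.isPerm ie)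
        ; maps-S = λ k → proj₁ (IsEmbedding.intoBlock ie k) , proj₁ (proj₂ (IsEmbedding.intoBlock ie k))
        ; maps-Sθ = maps-Sθ′
        ; reverses = IsEmbedding.thetaRev ie }
      ; block-closed = λ k _ → IsEmbedding.intoBlock ie k
      ; one-cycle = λ k l _ _ bl → IsEmbedding.oneCycle ie k l bl }
      where
      nothing-dead : ∀ z → live L z ≡ false → fwd Q z ≡ z
      nothing-dead z d with () ← trans (sym (ordered-live σ z)) d
      injQ : Injective _≡_ _≡_ (fwd Q)
      injQ {x} {y} e = trans (sym (proj₂ (IsEmbedding.isPerm ie) x)) (trans (cong (bwd Q) e) (proj₂ (IsEmbedding.isPerm ie) y))
      -- A preimage in S_θ of a point of S is impossible: the Q-orbit of a point of S stays in S and returns to it.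
      maps-Sθ′ : ∀ k → ∃ λ l → fwd Q (inj₂ k) ≡ inj₂ l
      maps-Sθ′ k with fwd Q (inj₂ k) in q
      ... | inj₂ l = l , refl
      ... | inj₁ l with orbit-period (fwd Q) injQ (inj₁ l)
      ...   | suc p , _ , _ , pe with iter-S Q ie p l
      ...     | l' , q' = ⊥-elim (S≢T (trans (sym q') (injQ (trans pe (sym q)))))

    live⇒embedding : ∀ (Q Qi : X n → X n) → LiveEmbedding blk L Q Qi → IsEmbedding blk (perm Q Qi)
    live⇒embedding Q Qi e = record
      { isPerm = rightInverse (partial e) , leftInverse (partial e)
      ; intoBlock = λ k → block-closed e k (ordered-live σ (inj₁ k))
      ; oneCycle = λ k l bl → one-cycle e k l (ordered-live σ (inj₁ k)) (ordered-live σ (inj₁ l)) bl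
      ; thetaRev = reverses (partial e) }

    toPath : Embedding blk → Path blk P L
    toPath (Q , ie) = encode blk L P (fwd Q) (bwd Q) L-distinct (embedding⇒live Q ie)

    toEmbedding : Path blk P L → Embedding blk
    toEmbedding p = perm (decode p) (decodeI p) , live⇒embedding (decode p) (decodeI p) (decode-embedding p L-distinct)

    toPath-cong : ∀ Q Q′ → Q ≈E Q′ → toPath Q ≡ toPath Q′
    toPath-cong (Q , ie) (Q′ , ie′) =
      encode-cong blk L P (fwd Q) (bwd Q) (fwd Q′) (bwd Q′) L-distinct (embedding⇒live Q ie) (embedding⇒live Q′ ie′)

    toEmbedding-toPath : ∀ Q → toEmbedding (toPath Q) ≈E Q
    toEmbedding-toPath (Q , ie) = decode-encode blk L P (fwd Q) (bwd Q) L-distinct (embedding⇒live Q ie)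

    toPath-toEmbedding : ∀ p → toPath (toEmbedding p) ≡ p
    toPath-toEmbedding p =
      trans (encode-cong blk L P (decode p) (decodeI p) (decode p) (decodeI p) L-distinct _ (decode-embedding p L-distinct) (λ _ → refl))
            (encode-decode p L-distinct)

    weight-toPath : IsPermutation P → ∀ Q → weight (toPath Q) ≡ ‖ P · proj₁ Q ‖
    weight-toPath isPerm (Q , ie) = +-cancelʳ-≡ (n + n) _ _ (begin
      weight p + (n + n)                                      ≡⟨ cycles-decode≡weight p L-distinct (permutation-on-ordered σ isPerm) ⟨
      cycles (composeLive (live L) P (decode p)) + liveSize L ≡⟨ cong₂ _+_ all-live (liveSize-ordered σ) ⟩
      ‖ P · Q ‖ + (n + n)                                     ∎)
      where
      open ≡-Reasoning
      p = toPath (Q , ie)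
      all-live : cycles (composeLive (live L) P (decode p)) ≡ ‖ P · Q ‖
      all-live = cycles-cong _ _ λ x →
        trans (composeLive-live (live L) P (decode p) x (ordered-live σ x))
              (decode-encode blk L P (fwd Q) (bwd Q) L-distinct (embedding⇒live Q ie) (fwd P x))

mainTheorem5 : ∀ {n : ℕ} (P : Perm n) (blk : Fin n → Fin n) (σ : Permutation′ n) →
    IsPBPair P blk →
    Σ (Embedding blk → Path blk P (ordered σ)) λ f →
    Σ (Path blk P (ordered σ) → Embedding blk) λ g →
      (∀ Q Q′ → Q ≈E Q′ → f Q ≡ f Q′) ×
      (∀ Q → g (f Q) ≈E Q) ×
      (∀ p → f (g p) ≡ p) ×
      (∀ (Q : Embedding blk) → weight (f Q) ≡ ‖ P · Σ.proj₁ Q ‖)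
mainTheorem5 P blk σ (isPerm , _) =
  toPath , toEmbedding , toPath-cong , toEmbedding-toPath , toPath-toEmbedding , weight-toPath isPerm
  where open Correspondence P blk σ
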